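{- There exists a function $g:\mathbb{N}\to\mathbb{N}$ such that the following holds. For every instance of MinAvgSTC in which all jobs have unit weight ($w_j=1$ for all $j$), with $K$ scenarios and an arbitrary number $m$ of machines ($m$ part of the input), and for every fixed ordering of the jobs (the jobs being labelled $1,\dots,n$ according to this ordering), there exists an optimal assignment $\varphi$ for MinAvgSTC whose full disbalance \[ \max_{j\in[n],\,k\in[K]}\Big\{\max_{i\in[m]}|\{j'\in J_i\cap S_k: j'\le j\}|-\min_{i\in[m]}|\{j'\in J_i\cap S_k: j'\le j\}|\Big\} \] is at most $g(K)$.
   Context: An instance consists of jobs $[n]$, machines $[m]$, job weights $w_j$, and scenarios $S_1,\dots,S_K\subseteq[n]$. A solution is an assignment $\varphi:[n]\to[m]$; write $J_i=\varphi^{ -1}(i)$. The cost of $\varphi$ in scenario $k$ is $G(\varphi,k)=\sum_{i=1}^m\sum_{j\in J_i\cap S_k} w_j\cdot|\{j'\in J_i\cap S_k: j'\le j\}|$; with unit weights this equals $\sum_{i=1}^m \tfrac12 |J_i\cap S_k|(|J_i\cap S_k|+1)$ and does not depend on the job order. MinAvgSTC asks to minimize $\sum_{k=1}^K G(\varphi,k)$. -}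

module Defs where

open import Data.Nat using (ℕ; zero; suc; _+_; _*_; _∸_; _⊔_; _⊓_)
open import Data.Fin using (Fin; zero; suc; _≟_; _≤?_)
open import Data.Fin.Subset using (Subset)
open import Data.Fin.Subset.Properties using (_∈?_)
open import Data.Bool using (Bool; true; false; if_then_else_; _∧_)
open import Relation.Nullary.Decidable using (does)
open import Function using (_∘_)

sumF : (n : ℕ) → (Fin n → ℕ) → ℕ
sumF zero    f = 0
sumF (suc n) f = f zero + sumF n (f ∘ suc)

maxF : (n : ℕ) → (Fin n → ℕ) → ℕ
maxF zero    f = 0
maxF (suc n) f = f zero ⊔ maxF n (f ∘ suc)

-- Minimum of f over Fin n (only meaningful for n ≥ 1; 0 for the empty range).
minF : (n : ℕ) → (Fin n → ℕ) → ℕ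
minF zero          f = 0
minF (suc zero)    f = f zero
minF (suc (suc n)) f = f zero ⊓ minF (suc n) (f ∘ suc)

-- Jobs are Fin n, ordered by the standard order on Fin (the fixed labelling);
-- machines are Fin m; scenarios are S : Fin K → Subset n.

prefixCount : {n m K : ℕ} → (Fin K → Subset n) → (Fin n → Fin m) →
              Fin m → Fin K → Fin n → ℕ
prefixCount {n} S φ i k j =
  sumF n (λ j' → if does (φ j' ≟ i) ∧ does (j' ∈? S k) ∧ does (j' ≤? j) then 1 else 0)

G : {n m K : ℕ} → (Fin n → ℕ) → (Fin K → Subset n) → (Fin n → Fin m) → Fin K → ℕ
G {n} {m} w S φ k =
  sumF m (λ i → sumF n (λ j →
    if does (φ j ≟ i) ∧ does (j ∈? S k) then w j * prefixCount S φ i k j else 0))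

totalCost : {n m K : ℕ} → (Fin n → ℕ) → (Fin K → Subset n) → (Fin n → Fin m) → ℕ
totalCost {K = K} w S φ = sumF K (G w S φ)

unitW : {n : ℕ} → Fin n → ℕ
unitW _ = 1

fullDisbalance : {n m K : ℕ} → (Fin K → Subset n) → (Fin n → Fin m) → ℕ
fullDisbalance {n} {m} {K} S φ =
  maxF n (λ j → maxF K (λ k →
    maxF m (λ i → prefixCount S φ i k j) ∸ minF m (λ i → prefixCount S φ i k j)))

-- Group the jobs into 2 ^ K types by the set of scenarios containing them. With unit weights the cost of a
-- machine in a scenario is the triangular number of its load there, and loads are sums of the type counts
-- y(i, t). Take an assignment minimising lexicographically the cost, Σ y(i, t)², and the sum over all job
-- prefixes of the squared prefix type counts. If y(a, t₀) ≥ y(b, t₀) + R, exchange h(t) jobs of each type t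
-- between a and b, with h between 0 and U = y(a, ·) - y(b, ·) and 0 < h(t₀) < U(t₀): this lowers Σ y², and it
-- does not raise the cost when the scenario projections L of U - 2h are together no longer than those of U.
-- Either h = ⌊U / 2⌋ works, or the projections of U are small, and then by pigeonhole two of the roundings
-- ⌊r U / R⌋, r ≤ V, have equal projections and their difference works. Hence type counts differ by at most V.
-- A stretch of prefixes in which a leads b by more than R in some type opens with a job of that type entering
-- a and closes with one entering b; swapping the two lowers the third component. So prefix type counts differ
-- by at most R, and prefix loads, being sums over 2 ^ K types, by at most 2 ^ K · R.

module Submission where

open import Defs
open import Data.Bool using (Bool; true; false; if_then_else_; _∧_)
open import Data.Bool.Properties using (∧-assoc)
open import Data.Empty using (⊥; ⊥-elim)
import Data.Fin as Fin
open import Data.Fin using (Fin; zero; suc; toℕ; fromℕ<; inject₁; _≟_; combine; funToFin; finToFun)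
open import Data.Fin.Properties using (finToFun-funToFin; combine-injective; toℕ-fromℕ<; toℕ<n; toℕ≤pred[n]; toℕ-inject₁; pigeonhole)
open import Data.Fin.Subset using (Subset)
open import Data.Fin.Subset.Properties using (_∈?_)
open import Data.Integer as ℤ using (ℤ; +_; -_; -[1+_]; ∣_∣; sign; _◃_)
import Data.Integer.Properties as ℤ
open import Data.Integer.Tactic.RingSolver using (solve-∀)
open import Data.List using (allFin)
open import Data.List.Extrema.Nat using (argmin; f[argmin]≤f[xs])
open import Data.List.Membership.Propositional.Properties using (∈-allFin)
open import Data.List.Relation.Unary.All using (lookup)
open import Data.Nat using (ℕ; zero; suc; _+_; _*_; _∸_; _^_; _≤_; _<_; _≤?_; _<?_; _⊔_; _⊓_; z≤n; s≤s; _<ᵇ_; _≤ᵇ_; _/_; _%_; NonZero; >-nonZero)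
open import Data.Nat.DivMod using (m≡m%n+[m/n]*n; m/n≤m; m%n<n; m/n<m; m≥n⇒m/n>0; /-monoˡ-≤; m*n/n≡m; m/n≡1+[m∸n]/n; m<n*o⇒m/o<n)
open import Data.Nat.Properties hiding (_≟_)
open import Data.Product using (Σ; _,_; _×_; proj₁; proj₂)
open import Data.Sign using (Sign)
open import Data.Sum using (inj₁; inj₂)
open import Function using (_∘_)
open import Relation.Binary.PropositionalEquality using (_≡_; _≢_; refl; sym; trans; cong; cong₂; subst; subst₂; module ≡-Reasoning)
open import Relation.Nullary using (¬_; Dec; yes; no)
open import Relation.Nullary.Decidable using (does; dec-true; dec-false)
open import Algebra.Properties.Semiring.Sum ℤ.+-*-semiring using (sum; sum-cong-≗; ∑-distrib-+; *-distribˡ-sum)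
import Algebra.Properties.CommutativeSemigroup +-commutativeSemigroup as +-CS
import Algebra.Properties.CommutativeSemigroup *-commutativeSemigroup as *-CS

ind : Bool → ℕ
ind b = if b then 1 else 0

ind-∧ : ∀ a b → ind (a ∧ b) ≡ ind a * ind b
ind-∧ true  b = sym (+-identityʳ (ind b))
ind-∧ false b = refl

ind≤1 : ∀ b → ind b ≤ 1
ind≤1 true  = s≤s z≤n
ind≤1 false = z≤n

[_≟_] : ∀ {m} → Fin m → Fin m → ℕ
[ x ≟ y ] = ind (does (x ≟ y))

[≟]-refl : ∀ {m} (x : Fin m) → [ x ≟ x ] ≡ 1
[≟]-refl x = cong ind (dec-true (x ≟ x) refl)

[≟]-≢ : ∀ {m} {x y : Fin m} → x ≢ y → [ x ≟ y ] ≡ 0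
[≟]-≢ {x = x} {y} x≢y = cong ind (dec-false (x ≟ y) x≢y)

[≟]*[≟]≢0 : ∀ {k l} {x y : Fin k} {u v : Fin l} → [ x ≟ y ] * [ u ≟ v ] ≢ 0 → x ≡ y × u ≡ v
[≟]*[≟]≢0 {x = x} {y} {u} {v} ≢0 with x ≟ y | u ≟ v
... | yes x≡y | yes u≡v = x≡y , u≡v
... | yes _   | no _    = ⊥-elim (≢0 refl)
... | no _    | _       = ⊥-elim (≢0 refl)

sumF-cong : ∀ n {f g : Fin n → ℕ} → (∀ i → f i ≡ g i) → sumF n f ≡ sumF n g
sumF-cong zero    f≗g = refl
sumF-cong (suc n) f≗g = cong₂ _+_ (f≗g zero) (sumF-cong n (f≗g ∘ suc))

sumF-zero : ∀ n → sumF n (λ _ → 0) ≡ 0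
sumF-zero zero    = refl
sumF-zero (suc n) = sumF-zero n

sumF-distrib-+ : ∀ n (f g : Fin n → ℕ) → sumF n (λ i → f i + g i) ≡ sumF n f + sumF n g
sumF-distrib-+ zero    f g = refl
sumF-distrib-+ (suc n) f g =
  trans (cong (_+_ (f zero + g zero)) (sumF-distrib-+ n (f ∘ suc) (g ∘ suc)))
        (+-CS.interchange (f zero) (g zero) _ _)

*-distribˡ-sumF : ∀ n c (f : Fin n → ℕ) → c * sumF n f ≡ sumF n (λ i → c * f i)
*-distribˡ-sumF zero    c f = *-zeroʳ c
*-distribˡ-sumF (suc n) c f =
  trans (*-distribˡ-+ c (f zero) _) (cong (_+_ (c * f zero)) (*-distribˡ-sumF n c (f ∘ suc)))

sumF-comm : ∀ n p (f : Fin n → Fin p → ℕ) →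
  sumF n (λ i → sumF p (f i)) ≡ sumF p (λ j → sumF n (λ i → f i j))
sumF-comm zero    p f = sym (sumF-zero p)
sumF-comm (suc n) p f =
  trans (cong (_+_ (sumF p (f zero))) (sumF-comm n p (f ∘ suc)))
        (sym (sumF-distrib-+ p (f zero) (λ j → sumF n (λ i → f (suc i) j))))

sumF-mono-≤ : ∀ n {f g : Fin n → ℕ} → (∀ i → f i ≤ g i) → sumF n f ≤ sumF n g
sumF-mono-≤ zero    f≤g = z≤n
sumF-mono-≤ (suc n) f≤g = +-mono-≤ (f≤g zero) (sumF-mono-≤ n (f≤g ∘ suc))

sumF-mono-< : ∀ n {f g : Fin n → ℕ} → (∀ i → f i ≤ g i) → ∀ i → f i < g i → sumF n f < sumF n g
sumF-mono-< (suc n) f≤g zero    fi<gi = +-mono-<-≤ fi<gi (sumF-mono-≤ n (f≤g ∘ suc))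
sumF-mono-< (suc n) f≤g (suc i) fi<gi = +-mono-≤-< (f≤g zero) (sumF-mono-< n (f≤g ∘ suc) i fi<gi)

sumF≤n*c : ∀ n c {f : Fin n → ℕ} → (∀ i → f i ≤ c) → sumF n f ≤ n * c
sumF≤n*c zero    c f≤c = z≤n
sumF≤n*c (suc n) c f≤c = +-mono-≤ (f≤c zero) (sumF≤n*c n c (f≤c ∘ suc))

f≤sumF : ∀ n (f : Fin n → ℕ) i → f i ≤ sumF n f
f≤sumF (suc n) f zero    = m≤m+n (f zero) _
f≤sumF (suc n) f (suc i) = ≤-trans (f≤sumF n (f ∘ suc) i) (m≤n+m _ (f zero))

sumF-δ : ∀ n (x : Fin n) (f : Fin n → ℕ) → sumF n (λ i → [ x ≟ i ] * f i) ≡ f x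
sumF-δ (suc n) zero    f = trans (cong₂ _+_ (+-identityʳ (f zero)) (sumF-zero n)) (+-identityʳ _)
sumF-δ (suc n) (suc x) f = sumF-δ n x (f ∘ suc)

-- Adding the two point masses at a and b to both sides turns the claim into a pointwise identity.
sumF-update₂ : ∀ n {a b : Fin n} → a ≢ b → (f g : Fin n → ℕ) →
  (∀ i → i ≢ a → i ≢ b → f i ≡ g i) → sumF n f + g a + g b ≡ sumF n g + f a + f b
sumF-update₂ n {a} {b} a≢b f g f≗g = begin
    sumF n f + g a + g b                  ≡⟨ +-assoc (sumF n f) (g a) (g b) ⟩
    sumF n f + (g a + g b)                ≡⟨ cong (_+_ (sumF n f)) (sym (masses g)) ⟩
    sumF n f + sumF n (λ i → mass i * g i) ≡⟨ sym (sumF-distrib-+ n f _) ⟩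
    sumF n (λ i → f i + mass i * g i)       ≡⟨ sumF-cong n pointwise ⟩
    sumF n (λ i → g i + mass i * f i)       ≡⟨ sumF-distrib-+ n g _ ⟩
    sumF n g + sumF n (λ i → mass i * f i) ≡⟨ cong (_+_ (sumF n g)) (masses f) ⟩
    sumF n g + (f a + f b)                ≡⟨ sym (+-assoc (sumF n g) (f a) (f b)) ⟩
    sumF n g + f a + f b                  ∎
  where
  open ≡-Reasoning
  mass : Fin n → ℕ
  mass i = [ a ≟ i ] + [ b ≟ i ]
  masses : ∀ h → sumF n (λ i → mass i * h i) ≡ h a + h b
  masses h = trans (sumF-cong n (λ i → *-distribʳ-+ (h i) [ a ≟ i ] [ b ≟ i ]))
                   (trans (sumF-distrib-+ n _ _) (cong₂ _+_ (sumF-δ n a h) (sumF-δ n b h)))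
  pointwise : ∀ i → f i + mass i * g i ≡ g i + mass i * f i
  pointwise i with a ≟ i | b ≟ i
  ... | yes refl | yes refl = ⊥-elim (a≢b refl)
  ... | yes refl | no _     = trans (cong (_+_ (f a)) (+-identityʳ (g a)))
                                (trans (+-comm (f a) (g a)) (cong (_+_ (g a)) (sym (+-identityʳ (f a)))))
  ... | no _     | yes refl = trans (cong (_+_ (f b)) (+-identityʳ (g b)))
                                (trans (+-comm (f b) (g b)) (cong (_+_ (g b)) (sym (+-identityʳ (f b)))))
  ... | no i≢a   | no i≢b   = cong (_+ 0) (f≗g i (i≢a ∘ sym) (i≢b ∘ sym))

weighted-sum-+ : ∀ n (w u v u′ v′ : Fin n → ℕ) → (∀ j → u j + v j ≡ u′ j + v′ j) →
  sumF n (λ j → w j * u j) + sumF n (λ j → w j * v j) ≡ sumF n (λ j → w j * u′ j) + sumF n (λ j → w j * v′ j)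
weighted-sum-+ n w u v u′ v′ eq =
  trans (sym (sumF-distrib-+ n _ _))
        (trans (sumF-cong n (λ j → trans (sym (*-distribˡ-+ (w j) (u j) (v j)))
                                         (trans (cong (w j *_) (eq j)) (*-distribˡ-+ (w j) (u′ j) (v′ j)))))
               (sumF-distrib-+ n _ _))

sumF-identity : ∀ N c (F F′ D D′ : Fin N → ℕ) → (∀ k → c * F′ k + D k ≡ c * F k + D′ k) →
  c * sumF N F′ + sumF N D ≡ c * sumF N F + sumF N D′
sumF-identity N c F F′ D D′ eq =
  trans (cong (_+ sumF N D) (*-distribˡ-sumF N c F′))
        (trans (sym (sumF-distrib-+ N _ _))
               (trans (sumF-cong N eq)
                      (trans (sumF-distrib-+ N _ _) (cong (_+ sumF N D′) (sym (*-distribˡ-sumF N c F))))))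

cancel-≤ : ∀ c {x x′ d d′} .{{_ : NonZero c}} → c * x′ + d ≡ c * x + d′ → d′ ≤ d → x′ ≤ x
cancel-≤ c {x} {x′} {d} eq d′≤d =
  *-cancelˡ-≤ c (+-cancelʳ-≤ d (c * x′) (c * x) (≤-trans (≤-reflexive eq) (+-monoʳ-≤ (c * x) d′≤d)))

cancel-< : ∀ c {x x′ d d′} → c * x′ + d ≡ c * x + d′ → d′ < d → x′ < x
cancel-< c {x} {x′} {d} eq d′<d =
  *-cancelˡ-< c x′ x (+-cancelʳ-< d (c * x′) (c * x) (≤-<-trans (≤-reflexive eq) (+-monoʳ-< (c * x) d′<d)))

lex-< : ∀ W {x x′ p p′} → x′ < x → p′ < W → W * x′ + p′ < W * x + p
lex-< W {x} {x′} {p} {p′} x′<x p′<W = begin-strict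
    W * x′ + p′     <⟨ +-monoʳ-< (W * x′) p′<W ⟩
    W * x′ + W      ≡⟨ trans (+-comm (W * x′) W) (sym (*-suc W x′)) ⟩
    W * suc x′      ≤⟨ *-monoʳ-≤ W x′<x ⟩
    W * x           ≤⟨ m≤m+n (W * x) p ⟩
    W * x + p       ∎
  where open ≤-Reasoning

maxF≤ : ∀ m (f : Fin m → ℕ) c → (∀ i → f i ≤ c) → maxF m f ≤ c
maxF≤ zero    f c f≤c = z≤n
maxF≤ (suc m) f c f≤c = ⊔-lub (f≤c zero) (maxF≤ m (f ∘ suc) c (f≤c ∘ suc))

minF-attained : ∀ m (f : Fin (suc m) → ℕ) → Σ (Fin (suc m)) λ i → minF (suc m) f ≡ f i
minF-attained zero    f = zero , refl
minF-attained (suc m) f with minF-attained m (f ∘ suc) | ≤-total (f zero) (minF (suc m) (f ∘ suc))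
... | i , eq | inj₁ f₀≤ = zero , m≤n⇒m⊓n≡m f₀≤
... | i , eq | inj₂ ≤f₀ = suc i , trans (m≥n⇒m⊓n≡n ≤f₀) eq

maxF∸minF≤ : ∀ m (f : Fin (suc m) → ℕ) D → (∀ a b → f a ≤ f b + D) → maxF (suc m) f ∸ minF (suc m) f ≤ D
maxF∸minF≤ m f D close with minF-attained m f
... | b , eq = m≤n+o⇒m∸n≤o (maxF (suc m) f) (minF (suc m) f)
                 (≤-trans (maxF≤ (suc m) f (f b + D) (λ a → close a b)) (≤-reflexive (cong (_+ D) (sym eq))))

first-from : ∀ {Q : ℕ → Set} → (∀ J → Dec (Q J)) → ∀ lo d → Q (lo + d) →
  Σ ℕ λ j → lo ≤ j × j ≤ lo + d × Q j × (∀ J → lo ≤ J → J < j → ¬ Q J)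
first-from {Q} Q? lo zero q =
  lo , ≤-refl , m≤m+n lo 0 , subst Q (+-identityʳ lo) q , λ J lo≤J J<lo → ⊥-elim (≤⇒≯ lo≤J J<lo)
first-from {Q} Q? lo (suc d) q with Q? lo
... | yes q₀ = lo , ≤-refl , m≤m+n lo (suc d) , q₀ , λ J lo≤J J<lo → ⊥-elim (≤⇒≯ lo≤J J<lo)
... | no ¬q₀ with first-from Q? (suc lo) d (subst Q (+-suc lo d) q)
...   | j , lo<j , j≤ , qj , below =
  j , ≤-trans (n≤1+n lo) lo<j , ≤-trans j≤ (≤-reflexive (sym (+-suc lo d))) , qj , earlier
  where
  earlier : ∀ J → lo ≤ J → J < j → ¬ Q J
  earlier J lo≤J J<j with m≤n⇒m<n∨m≡n lo≤J
  ... | inj₁ lo<J  = below J lo<J J<j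
  ... | inj₂ refl = ¬q₀

minimiser : ∀ n m (F : (Fin n → Fin (suc m)) → ℕ) → (∀ {φ ψ} → (∀ j → φ j ≡ ψ j) → F φ ≡ F ψ) →
  Σ (Fin n → Fin (suc m)) λ φ → ∀ ψ → F φ ≤ F ψ
minimiser n m F F-cong = decode best , λ ψ →
  subst (F (decode best) ≤_) (F-cong (finToFun-funToFin ψ))
        (lookup (f[argmin]≤f[xs] {f = F ∘ decode} origin (allFin (suc m ^ n))) (∈-allFin (funToFin ψ)))
  where
  decode : Fin (suc m ^ n) → Fin n → Fin (suc m)
  decode = finToFun
  origin : Fin (suc m ^ n)
  origin = funToFin (λ (_ : Fin n) → zero)
  best : Fin (suc m ^ n)
  best = argmin (F ∘ decode) origin (allFin (suc m ^ n))

-- Unit weights: the cost of a machine is a triangular number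

triangular : ℕ → ℕ
triangular zero    = 0
triangular (suc c) = suc c + triangular c

2*triangular : ∀ x → 2 * triangular x ≡ x * x + x
2*triangular zero    = refl
2*triangular (suc x) = begin
    2 * (suc x + triangular x)      ≡⟨ *-distribˡ-+ 2 (suc x) (triangular x) ⟩
    2 * suc x + 2 * triangular x    ≡⟨ cong (_+_ (2 * suc x)) (2*triangular x) ⟩
    2 * suc x + (x * x + x)         ≡⟨ cong (_+_ (2 * suc x)) (trans (+-comm (x * x) x) (sym (*-suc x x))) ⟩
    2 * suc x + x * suc x           ≡⟨ sym (*-distribʳ-+ (suc x) 2 x) ⟩
    suc (suc x) * suc x             ≡⟨ *-comm (suc (suc x)) (suc x) ⟩
    suc x * suc (suc x)             ≡⟨ trans (*-suc (suc x) (suc x)) (+-comm (suc x) _) ⟩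
    suc x * suc x + suc x           ∎
  where open ≡-Reasoning

count : ∀ {n} → (Fin n → Bool) → ℕ
count {n} P = sumF n (ind ∘ P)

before : ∀ {n} → ℕ → Fin n → ℕ
before J j = ind (toℕ j <ᵇ J)

before-< : ∀ {n J} (j : Fin n) → toℕ j < J → before J j ≡ 1
before-< {J = suc J} zero    _         = refl
before-< {J = suc J} (suc j) (s≤s j<J) = before-< j j<J

before-≥ : ∀ {n J} (j : Fin n) → J ≤ toℕ j → before J j ≡ 0
before-≥ {J = zero}  j       _         = refl
before-≥ {J = suc J} (suc j) (s≤s J≤j) = before-≥ j J≤j

before-suc : ∀ {n} (x j : Fin n) → before (suc (toℕ x)) j ≡ before (toℕ x) j + [ x ≟ j ]
before-suc zero    zero    = refl
before-suc zero    (suc j) = refl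
before-suc (suc x) zero    = refl
before-suc (suc x) (suc j) = before-suc x j

triangular-sum : ∀ n (P : Fin n → Bool) →
  sumF n (λ j → ind (P j) * sumF n (λ j′ → ind (P j′) * before (suc (toℕ j)) j′))
    ≡ triangular (count P)
triangular-sum zero    P = refl
-- The left side is displayed unfolded at the first job, where before 1 (suc j′) and before (2 + toℕ j) zero
-- have already reduced to 0 and 1.
triangular-sum (suc n) P = begin
    p * (p * 1 + sumF n (λ j′ → ind (P (suc j′)) * 0))
      + sumF n (λ j → ind (P (suc j)) * (p * 1 + inner j))
  ≡⟨ cong₂ _+_ first-job (sumF-cong n split) ⟩
    p + sumF n (λ j → p * ind (P (suc j)) + ind (P (suc j)) * inner j)
  ≡⟨ cong (_+_ p) (sumF-distrib-+ n _ _) ⟩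
    p + (sumF n (λ j → p * ind (P (suc j))) + sumF n (λ j → ind (P (suc j)) * inner j))
  ≡⟨ cong₂ (λ x y → p + (x + y)) (sym (*-distribˡ-sumF n p _)) (triangular-sum n (P ∘ suc)) ⟩
    p + (p * count (P ∘ suc) + triangular (count (P ∘ suc)))
  ≡⟨ step (P zero) (count (P ∘ suc)) ⟩
    triangular (count P) ∎
  where
  open ≡-Reasoning
  p : ℕ
  p = ind (P zero)
  inner : Fin n → ℕ
  inner j = sumF n (λ j′ → ind (P (suc j′)) * before (suc (toℕ j)) j′)
  idem : ∀ b → ind b * (ind b * 1 + 0) ≡ ind b
  idem true  = refl
  idem false = refl
  first-job : p * (p * 1 + sumF n (λ j′ → ind (P (suc j′)) * 0)) ≡ p
  first-job = trans (cong (λ z → p * (p * 1 + z))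
                          (trans (sumF-cong n (λ j′ → *-zeroʳ (ind (P (suc j′))))) (sumF-zero n)))
                    (idem (P zero))
  split : ∀ j → ind (P (suc j)) * (p * 1 + inner j) ≡ p * ind (P (suc j)) + ind (P (suc j)) * inner j
  split j = trans (*-distribˡ-+ (ind (P (suc j))) (p * 1) (inner j))
                  (cong (_+ ind (P (suc j)) * inner j)
                        (trans (cong (ind (P (suc j)) *_) (*-identityʳ p)) (*-comm (ind (P (suc j))) p)))
  step : ∀ b c → ind b + (ind b * c + triangular c) ≡ triangular (ind b + c)
  step true  c = cong (λ z → suc (z + triangular c)) (+-identityʳ c)
  step false c = refl

m≤ᵇn≡m<ᵇ1+n : ∀ a b → (a ≤ᵇ b) ≡ (a <ᵇ suc b)
m≤ᵇn≡m<ᵇ1+n zero    b = refl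
m≤ᵇn≡m<ᵇ1+n (suc a) b = refl

module _ {n m K : ℕ} (S : Fin K → Subset n) where

  onMachineIn : (Fin n → Fin m) → Fin m → Fin K → Fin n → Bool
  onMachineIn φ i k j = does (φ j ≟ i) ∧ does (j ∈? S k)

  prefixCount-before : ∀ φ i k j →
    prefixCount S φ i k j ≡ sumF n (λ j′ → ind (onMachineIn φ i k j′) * before (suc (toℕ j)) j′)
  prefixCount-before φ i k j = sumF-cong n λ j′ →
    trans (cong ind (sym (∧-assoc (does (φ j′ ≟ i)) (does (j′ ∈? S k)) _)))
          (trans (ind-∧ (onMachineIn φ i k j′) _)
                 (cong (λ z → ind (onMachineIn φ i k j′) * ind z) (m≤ᵇn≡m<ᵇ1+n (toℕ j′) (toℕ j))))

  G-unitW : ∀ φ k → G unitW S φ k ≡ sumF m (λ i → triangular (count (onMachineIn φ i k)))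
  G-unitW φ k = sumF-cong m λ i →
    trans (sumF-cong n (λ j → trans (if-1* (onMachineIn φ i k j) _)
                                    (cong (ind (onMachineIn φ i k j) *_) (prefixCount-before φ i k j))))
          (triangular-sum n (onMachineIn φ i k))
    where
    if-1* : ∀ b x → (if b then 1 * x else 0) ≡ ind b * x
    if-1* true  x = refl
    if-1* false x = refl

-- Job types and type counts

Type : ℕ → Set
Type K = Fin (2 ^ K)

-- A type t ∈ Fin (2 ^ K) encodes the set of scenarios containing a job, as a function Fin K → Fin 2.
occurs : ∀ {K} → Type K → Fin K → ℕ
occurs t k = toℕ (finToFun t k)

occurs≤1 : ∀ {K} (t : Type K) (k : Fin K) → occurs t k ≤ 1
occurs≤1 t k = toℕ≤pred[n] (finToFun t k)

fromBool : Bool → Fin 2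
fromBool false = zero
fromBool true  = suc zero

module _ {n K : ℕ} (S : Fin K → Subset n) where

  type : Fin n → Type K
  type j = funToFin (λ k → fromBool (does (j ∈? S k)))

  occurs-type : ∀ j k → occurs (type j) k ≡ ind (does (j ∈? S k))
  occurs-type j k = trans (cong toℕ (finToFun-funToFin _ k)) (toℕ-fromBool (does (j ∈? S k)))
    where
    toℕ-fromBool : ∀ b → toℕ (fromBool b) ≡ ind b
    toℕ-fromBool false = refl
    toℕ-fromBool true  = refl

  sumF-by-type : ∀ (f : Fin n → ℕ) k →
    sumF n (λ j → ind (does (j ∈? S k)) * f j)
      ≡ sumF (2 ^ K) (λ t → occurs t k * sumF n (λ j → [ type j ≟ t ] * f j))
  sumF-by-type f k = sym (begin
      sumF (2 ^ K) (λ t → occurs t k * sumF n (λ j → [ type j ≟ t ] * f j))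
    ≡⟨ sumF-cong (2 ^ K) (λ t → *-distribˡ-sumF n (occurs t k) _) ⟩
      sumF (2 ^ K) (λ t → sumF n (λ j → occurs t k * ([ type j ≟ t ] * f j)))
    ≡⟨ sumF-comm (2 ^ K) n _ ⟩
      sumF n (λ j → sumF (2 ^ K) (λ t → occurs t k * ([ type j ≟ t ] * f j)))
    ≡⟨ sumF-cong n (λ j → sumF-cong (2 ^ K) (λ t → *-CS.x∙yz≈y∙xz (occurs t k) [ type j ≟ t ] (f j))) ⟩
      sumF n (λ j → sumF (2 ^ K) (λ t → [ type j ≟ t ] * (occurs t k * f j)))
    ≡⟨ sumF-cong n (λ j → sumF-δ (2 ^ K) (type j) (λ t → occurs t k * f j)) ⟩
      sumF n (λ j → occurs (type j) k * f j)
    ≡⟨ sumF-cong n (λ j → cong (_* f j) (occurs-type j k)) ⟩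
      sumF n (λ j → ind (does (j ∈? S k)) * f j) ∎)
    where open ≡-Reasoning

module _ {n m K : ℕ} (S : Fin K → Subset n) where

  typeCount : (Fin n → Fin m) → Fin m → Type K → ℕ
  typeCount φ i t = sumF n (λ j → [ type S j ≟ t ] * [ φ j ≟ i ])

  prefixTypeCount : (Fin n → Fin m) → Fin m → Type K → ℕ → ℕ
  prefixTypeCount φ i t J = sumF n (λ j → [ type S j ≟ t ] * ([ φ j ≟ i ] * before J j))

  load : (Fin n → Fin m) → Fin m → Fin K → ℕ
  load φ i k = sumF (2 ^ K) (λ t → occurs t k * typeCount φ i t)

  cost : (Fin n → Fin m) → ℕ
  cost φ = sumF K (λ k → sumF m (λ i → triangular (load φ i k)))

  totalCost-unitW : ∀ φ → totalCost unitW S φ ≡ cost φ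
  totalCost-unitW φ = sumF-cong K λ k →
    trans (G-unitW S φ k) (sumF-cong m (λ i → cong triangular (count-onMachineIn i k)))
    where
    count-onMachineIn : ∀ i k → count (onMachineIn S φ i k) ≡ load φ i k
    count-onMachineIn i k = trans (sumF-cong n (λ j → trans (ind-∧ (does (φ j ≟ i)) _) (*-comm [ φ j ≟ i ] _)))
                           (sumF-by-type S (λ j → [ φ j ≟ i ]) k)

  prefixCount-by-type : ∀ φ i k j →
    prefixCount S φ i k j ≡ sumF (2 ^ K) (λ t → occurs t k * prefixTypeCount φ i t (suc (toℕ j)))
  prefixCount-by-type φ i k j =
    trans (prefixCount-before S φ i k j)
          (trans (sumF-cong n (λ j′ → trans (cong (_* before (suc (toℕ j)) j′) (ind-∧ (does (φ j′ ≟ i)) _))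
                                            (*-CS.xy∙z≈y∙xz [ φ j′ ≟ i ] _ _)))
                 (sumF-by-type S (λ j′ → [ φ j′ ≟ i ] * before (suc (toℕ j)) j′) k))

  prefixTypeCount-zero : ∀ φ i t → prefixTypeCount φ i t 0 ≡ 0
  prefixTypeCount-zero φ i t =
    trans (sumF-cong n (λ j → trans (cong ([ type S j ≟ t ] *_) (*-zeroʳ [ φ j ≟ i ])) (*-zeroʳ [ type S j ≟ t ])))
          (sumF-zero n)

  prefixTypeCount-all : ∀ φ i t → prefixTypeCount φ i t n ≡ typeCount φ i t
  prefixTypeCount-all φ i t = sumF-cong n λ j →
    cong ([ type S j ≟ t ] *_) (trans (cong ([ φ j ≟ i ] *_) (before-< j (toℕ<n j))) (*-identityʳ _))

  prefixTypeCount-suc : ∀ φ i t (x : Fin n) →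
    prefixTypeCount φ i t (suc (toℕ x)) ≡ prefixTypeCount φ i t (toℕ x) + [ type S x ≟ t ] * [ φ x ≟ i ]
  prefixTypeCount-suc φ i t x =
    trans (sumF-cong n split) (trans (sumF-distrib-+ n _ _) (cong (_+_ (prefixTypeCount φ i t (toℕ x)))
      (trans (sumF-cong n (λ j → *-CS.x∙yz≈z∙xy [ type S j ≟ t ] [ φ j ≟ i ] [ x ≟ j ]))
             (sumF-δ n x (λ j → [ type S j ≟ t ] * [ φ j ≟ i ])))))
    where
    split : ∀ j → [ type S j ≟ t ] * ([ φ j ≟ i ] * before (suc (toℕ x)) j)
                ≡ [ type S j ≟ t ] * ([ φ j ≟ i ] * before (toℕ x) j) + [ type S j ≟ t ] * ([ φ j ≟ i ] * [ x ≟ j ])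
    split j = trans (cong (λ z → [ type S j ≟ t ] * ([ φ j ≟ i ] * z)) (before-suc x j))
                    (trans (cong ([ type S j ≟ t ] *_) (*-distribˡ-+ [ φ j ≟ i ] _ _)) (*-distribˡ-+ [ type S j ≟ t ] _ _))

  prefixTypeCount≤n : ∀ φ i t J → prefixTypeCount φ i t J ≤ n
  prefixTypeCount≤n φ i t J = ≤-trans (sumF≤n*c n 1 λ j →
      *-mono-≤ (ind≤1 (does (type S j ≟ t))) (*-mono-≤ (ind≤1 (does (φ j ≟ i))) (ind≤1 (toℕ j <ᵇ J))))
    (≤-reflexive (*-identityʳ n))

  typeCount≤n : ∀ φ i t → typeCount φ i t ≤ n
  typeCount≤n φ i t = subst (_≤ n) (prefixTypeCount-all φ i t) (prefixTypeCount≤n φ i t n)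

  prefixTypeCount-cong : ∀ {φ ψ} → (∀ j → φ j ≡ ψ j) → ∀ i t J → prefixTypeCount φ i t J ≡ prefixTypeCount ψ i t J
  prefixTypeCount-cong φ≗ψ i t J = sumF-cong n (λ j → cong (λ z → [ type S j ≟ t ] * ([ z ≟ i ] * before J j)) (φ≗ψ j))

  typeCount-cong : ∀ {φ ψ} → (∀ j → φ j ≡ ψ j) → ∀ i t → typeCount φ i t ≡ typeCount ψ i t
  typeCount-cong {φ} {ψ} φ≗ψ i t =
    trans (sym (prefixTypeCount-all φ i t)) (trans (prefixTypeCount-cong φ≗ψ i t n) (prefixTypeCount-all ψ i t))

  cost-cong : ∀ {φ ψ} → (∀ i t → typeCount φ i t ≡ typeCount ψ i t) → cost φ ≡ cost ψ
  cost-cong same = sumF-cong K λ k → sumF-cong m λ i →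
    cong triangular (sumF-cong (2 ^ K) (λ t → cong (occurs t k *_) (same i t)))

-- Integer vectors and linear forms

∣_∣² : ℤ → ℕ
∣ i ∣² = ∣ i ∣ * ∣ i ∣

+∣i∣²≡i*i : ∀ i → + ∣ i ∣² ≡ i ℤ.* i
+∣i∣²≡i*i (+ n)    = ℤ.pos-* n n
+∣i∣²≡i*i -[1+ n ] = refl

+m-+n≡+[m∸n] : ∀ {m n} → n ≤ m → + m ℤ.- + n ≡ + (m ∸ n)
+m-+n≡+[m∸n] {m} {n} n≤m = trans (ℤ.m-n≡m⊖n m n) (ℤ.⊖-≥ n≤m)

+m-+n≡-[n∸m] : ∀ {m n} → m ≤ n → + m ℤ.- + n ≡ - + (n ∸ m)
+m-+n≡-[n∸m] {m} {n} m≤n = trans (ℤ.m-n≡m⊖n m n) (ℤ.⊖-≤ m≤n)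

+m-+n≡+[m∸n]-+[n∸m] : ∀ m n → + m ℤ.- + n ≡ + (m ∸ n) ℤ.- + (n ∸ m)
+m-+n≡+[m∸n]-+[n∸m] m n with ≤-total n m
... | inj₁ n≤m rewrite m≤n⇒m∸n≡0 n≤m = trans (+m-+n≡+[m∸n] n≤m) (sym (ℤ.+-identityʳ _))
... | inj₂ m≤n rewrite m≤n⇒m∸n≡0 m≤n = trans (+m-+n≡-[n∸m] m≤n) (sym (ℤ.+-identityˡ _))

+m≡+[m%n]+[m/n]*n : ∀ m n .{{_ : NonZero n}} → + m ≡ + (m % n) ℤ.+ + (m / n) ℤ.* + n
+m≡+[m%n]+[m/n]*n m n =
  trans (cong +_ (m≡m%n+[m/n]*n m n)) (trans (ℤ.pos-+ (m % n) _) (cong (λ z → + (m % n) ℤ.+ z) (ℤ.pos-* (m / n) n)))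

∣+m-+n∣≤m⊔n : ∀ m n → ∣ + m ℤ.- + n ∣ ≤ m ⊔ n
∣+m-+n∣≤m⊔n m n rewrite ℤ.m-n≡m⊖n m n = ℤ.∣m⊝n∣≤m⊔n m n

+-solve : ∀ {x′ p x q} → x′ + p ≡ x + q → + x ≡ + x′ ℤ.+ + p ℤ.- + q
+-solve {x′} {p} {x} {q} eq = begin
    + x                       ≡⟨ add-sub (+ x) (+ q) ⟩
    + x ℤ.+ + q ℤ.- + q       ≡⟨ cong (ℤ._- + q) (sym (ℤ.pos-+ x q)) ⟩
    + (x + q) ℤ.- + q         ≡⟨ cong (λ z → + z ℤ.- + q) (sym eq) ⟩
    + (x′ + p) ℤ.- + q        ≡⟨ cong (ℤ._- + q) (ℤ.pos-+ x′ p) ⟩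
    + x′ ℤ.+ + p ℤ.- + q      ∎
  where
  open ≡-Reasoning
  add-sub : ∀ x q → x ≡ x ℤ.+ q ℤ.- q
  add-sub = solve-∀

∣sum∣≤sumF∣∣ : ∀ n (f : Fin n → ℤ) → ∣ sum f ∣ ≤ sumF n (∣_∣ ∘ f)
∣sum∣≤sumF∣∣ zero    f = z≤n
∣sum∣≤sumF∣∣ (suc n) f = ≤-trans (ℤ.∣i+j∣≤∣i∣+∣j∣ (f zero) _) (+-monoʳ-≤ ∣ f zero ∣ (∣sum∣≤sumF∣∣ n (f ∘ suc)))

sum-pos : ∀ n (f : Fin n → ℕ) → sum (λ i → + f i) ≡ + sumF n f
sum-pos zero    f = refl
sum-pos (suc n) f = trans (cong (λ z → + f zero ℤ.+ z) (sum-pos n (f ∘ suc))) (sym (ℤ.pos-+ (f zero) _))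

module LinearForms {T K : ℕ} (A : Fin T → Fin K → ℕ) where

  L : (Fin T → ℤ) → Fin K → ℤ
  L u k = sum (λ t → + A t k ℤ.* u t)

  N : (Fin T → ℤ) → ℕ
  N u = sumF K (λ k → ∣ L u k ∣²)

  L-cong : ∀ {u v} → (∀ t → u t ≡ v t) → ∀ k → L u k ≡ L v k
  L-cong u≗v k = sum-cong-≗ (λ t → cong (+ A t k ℤ.*_) (u≗v t))

  L-* : ∀ c (u : Fin T → ℤ) k → L (λ t → c ℤ.* u t) k ≡ c ℤ.* L u k
  L-* c u k = trans (sum-cong-≗ (λ t → x*yz≡y*xz (+ A t k) c (u t))) (sym (*-distribˡ-sum c (λ t → + A t k ℤ.* u t)))
    where
    x*yz≡y*xz : ∀ x y z → x ℤ.* (y ℤ.* z) ≡ y ℤ.* (x ℤ.* z)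
    x*yz≡y*xz = solve-∀

  L-linear : ∀ a b (u v w : Fin T → ℤ) → (∀ t → w t ≡ a ℤ.* u t ℤ.+ b ℤ.* v t) →
             ∀ k → L w k ≡ a ℤ.* L u k ℤ.+ b ℤ.* L v k
  L-linear a b u v w w≗ k = begin
      L w k
    ≡⟨ sum-cong-≗ (λ t → trans (cong (+ A t k ℤ.*_) (w≗ t)) (distrib a b (+ A t k) (u t) (v t))) ⟩
      sum (λ t → a ℤ.* (+ A t k ℤ.* u t) ℤ.+ b ℤ.* (+ A t k ℤ.* v t))
    ≡⟨ ∑-distrib-+ (λ t → a ℤ.* (+ A t k ℤ.* u t)) (λ t → b ℤ.* (+ A t k ℤ.* v t)) ⟩
      sum (λ t → a ℤ.* (+ A t k ℤ.* u t)) ℤ.+ sum (λ t → b ℤ.* (+ A t k ℤ.* v t))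
    ≡⟨ sym (cong₂ ℤ._+_ (*-distribˡ-sum a (λ t → + A t k ℤ.* u t)) (*-distribˡ-sum b (λ t → + A t k ℤ.* v t))) ⟩
      a ℤ.* L u k ℤ.+ b ℤ.* L v k ∎
    where
    open ≡-Reasoning
    distrib : ∀ a b x y z → x ℤ.* (a ℤ.* y ℤ.+ b ℤ.* z) ≡ a ℤ.* (x ℤ.* y) ℤ.+ b ℤ.* (x ℤ.* z)
    distrib = solve-∀

  L-diff : ∀ (x y : Fin T → ℕ) k →
    + sumF T (λ t → A t k * x t) ℤ.- + sumF T (λ t → A t k * y t) ≡ L (λ t → + x t ℤ.- + y t) k
  L-diff x y k = sym (begin
      L (λ t → + x t ℤ.- + y t) k
    ≡⟨ L-linear (+ 1) (- + 1) (λ t → + x t) (λ t → + y t) _ (λ t → as-combination (+ x t) (+ y t)) k ⟩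
      + 1 ℤ.* L (λ t → + x t) k ℤ.+ - + 1 ℤ.* L (λ t → + y t) k
    ≡⟨ cong₂ (λ p q → + 1 ℤ.* p ℤ.+ - + 1 ℤ.* q) (L-pos x) (L-pos y) ⟩
      + 1 ℤ.* + sumF T (λ t → A t k * x t) ℤ.+ - + 1 ℤ.* + sumF T (λ t → A t k * y t)
    ≡⟨ sym (as-combination (+ sumF T (λ t → A t k * x t)) (+ sumF T (λ t → A t k * y t))) ⟩
      + sumF T (λ t → A t k * x t) ℤ.- + sumF T (λ t → A t k * y t) ∎)
    where
    open ≡-Reasoning
    as-combination : ∀ p q → p ℤ.- q ≡ + 1 ℤ.* p ℤ.+ - + 1 ℤ.* q
    as-combination = solve-∀
    L-pos : ∀ x → L (λ t → + x t) k ≡ + sumF T (λ t → A t k * x t)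
    L-pos x = trans (sum-cong-≗ (λ t → sym (ℤ.pos-* (A t k) (x t)))) (sum-pos T (λ t → A t k * x t))

  ∣L∣≤sumF∣∣ : (∀ t k → A t k ≤ 1) → ∀ u k → ∣ L u k ∣ ≤ sumF T (λ t → ∣ u t ∣)
  ∣L∣≤sumF∣∣ A≤1 u k = ≤-trans (∣sum∣≤sumF∣∣ T _) (sumF-mono-≤ T λ t →
    ≤-trans (≤-reflexive (ℤ.abs-* (+ A t k) (u t)))
            (≤-trans (*-monoˡ-≤ ∣ u t ∣ (A≤1 t k)) (≤-reflexive (+-identityʳ _))))

-- The two sign cases of square-exchange, in the shape its goal takes once the zero side has been rewritten.
square-exchange⁺ : ∀ d p → p ≤ d → ∣ + d ℤ.- + 2 ℤ.* (+ p ℤ.- + 0) ∣² + 4 * (p * (d ∸ p) + 0) ≡ ∣ + d ∣²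
square-exchange⁺ d p p≤d = ℤ.+-injective (begin
    + (∣ D ∣² + 4 * (p * (d ∸ p) + 0))
  ≡⟨ ℤ.pos-+ ∣ D ∣² (4 * (p * (d ∸ p) + 0)) ⟩
    + ∣ D ∣² ℤ.+ + (4 * (p * (d ∸ p) + 0))
  ≡⟨ cong₂ ℤ._+_ (+∣i∣²≡i*i D) (trans (ℤ.pos-* 4 (p * (d ∸ p) + 0)) (cong (+ 4 ℤ.*_) (trans (ℤ.pos-+ (p * (d ∸ p)) 0)
        (cong (λ z → z ℤ.+ + 0) (trans (ℤ.pos-* p (d ∸ p)) (cong (+ p ℤ.*_) (sym (+m-+n≡+[m∸n] p≤d)))))))) ⟩
    D ℤ.* D ℤ.+ + 4 ℤ.* (+ p ℤ.* (+ d ℤ.- + p) ℤ.+ + 0)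
  ≡⟨ identity (+ d) (+ p) ⟩
    + d ℤ.* + d
  ≡⟨ sym (+∣i∣²≡i*i (+ d)) ⟩
    + ∣ + d ∣² ∎)
  where
  open ≡-Reasoning
  D : ℤ
  D = + d ℤ.- + 2 ℤ.* (+ p ℤ.- + 0)
  identity : ∀ d p → (d ℤ.- + 2 ℤ.* (p ℤ.- + 0)) ℤ.* (d ℤ.- + 2 ℤ.* (p ℤ.- + 0))
                       ℤ.+ + 4 ℤ.* (p ℤ.* (d ℤ.- p) ℤ.+ + 0) ≡ d ℤ.* d
  identity = solve-∀

square-exchange⁻ : ∀ d q → q ≤ d → ∣ - + d ℤ.- + 2 ℤ.* (+ 0 ℤ.- + q) ∣² + 4 * (q * (d ∸ q)) ≡ ∣ - + d ∣²
square-exchange⁻ d q q≤d = ℤ.+-injective (begin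
    + (∣ D ∣² + 4 * (q * (d ∸ q)))
  ≡⟨ ℤ.pos-+ ∣ D ∣² (4 * (q * (d ∸ q))) ⟩
    + ∣ D ∣² ℤ.+ + (4 * (q * (d ∸ q)))
  ≡⟨ cong₂ ℤ._+_ (+∣i∣²≡i*i D) (trans (ℤ.pos-* 4 (q * (d ∸ q)))
        (cong (+ 4 ℤ.*_) (trans (ℤ.pos-* q (d ∸ q)) (cong (+ q ℤ.*_) (sym (+m-+n≡+[m∸n] q≤d)))))) ⟩
    D ℤ.* D ℤ.+ + 4 ℤ.* (+ q ℤ.* (+ d ℤ.- + q))
  ≡⟨ identity (+ d) (+ q) ⟩
    (- + d) ℤ.* (- + d)
  ≡⟨ sym (+∣i∣²≡i*i (- + d)) ⟩
    + ∣ - + d ∣² ∎)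
  where
  open ≡-Reasoning
  D : ℤ
  D = - + d ℤ.- + 2 ℤ.* (+ 0 ℤ.- + q)
  identity : ∀ d q → (- d ℤ.- + 2 ℤ.* (+ 0 ℤ.- q)) ℤ.* (- d ℤ.- + 2 ℤ.* (+ 0 ℤ.- q))
                       ℤ.+ + 4 ℤ.* (q ℤ.* (d ℤ.- q)) ≡ (- d) ℤ.* (- d)
  identity = solve-∀

-- With U = x - y and h = p - q lying between 0 and U: (U - 2h)² + 4 h (U - h) = U².
square-exchange : ∀ x y p q → p ≤ x ∸ y → q ≤ y ∸ x →
  ∣ (+ x ℤ.- + y) ℤ.- + 2 ℤ.* (+ p ℤ.- + q) ∣² + 4 * (p * (x ∸ y ∸ p) + q * (y ∸ x ∸ q))
    ≡ ∣ + x ℤ.- + y ∣²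
square-exchange x y p q p≤ q≤ with ≤-total y x
... | inj₁ y≤x rewrite n≤0⇒n≡0 (≤-trans q≤ (≤-reflexive (m≤n⇒m∸n≡0 y≤x))) | m≤n⇒m∸n≡0 y≤x
                     | +m-+n≡+[m∸n] y≤x = square-exchange⁺ (x ∸ y) p p≤
... | inj₂ x≤y rewrite n≤0⇒n≡0 (≤-trans p≤ (≤-reflexive (m≤n⇒m∸n≡0 x≤y))) | m≤n⇒m∸n≡0 x≤y
                     | +m-+n≡-[n∸m] x≤y = square-exchange⁻ (y ∸ x) q q≤

funToFin-injective : ∀ {K m} (f g : Fin K → Fin m) → funToFin f ≡ funToFin g → ∀ k → f k ≡ g k
funToFin-injective f g eq k =
  trans (sym (finToFun-funToFin f k)) (trans (cong (λ x → finToFun x k) eq) (finToFun-funToFin g k))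

fromSign : Sign → Fin 2
fromSign Sign.- = zero
fromSign Sign.+ = suc zero

encode : ∀ C (z : ℤ) → ∣ z ∣ ≤ C → Fin (2 * suc C)
encode C z ∣z∣≤C = combine (fromSign (sign z)) (fromℕ< (s≤s ∣z∣≤C))

encode-injective : ∀ C {z w : ℤ} (p : ∣ z ∣ ≤ C) (q : ∣ w ∣ ≤ C) → encode C z p ≡ encode C w q → z ≡ w
encode-injective C {z} {w} p q eq = begin
    z                  ≡⟨ sym (ℤ.◃-inverse z) ⟩
    sign z ◃ ∣ z ∣     ≡⟨ cong₂ _◃_ (fromSign-injective (sign z) (sign w) (proj₁ parts)) absolute ⟩
    sign w ◃ ∣ w ∣     ≡⟨ ℤ.◃-inverse w ⟩
    w                  ∎
  where
  open ≡-Reasoning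
  parts : fromSign (sign z) ≡ fromSign (sign w) × fromℕ< (s≤s p) ≡ fromℕ< (s≤s q)
  parts = combine-injective (fromSign (sign z)) (fromℕ< (s≤s p)) (fromSign (sign w)) (fromℕ< (s≤s q)) eq
  fromSign-injective : ∀ s r → fromSign s ≡ fromSign r → s ≡ r
  fromSign-injective Sign.- Sign.- _ = refl
  fromSign-injective Sign.+ Sign.+ _ = refl
  absolute : ∣ z ∣ ≡ ∣ w ∣
  absolute = trans (sym (toℕ-fromℕ< (s≤s p))) (trans (cong toℕ (proj₂ parts)) (toℕ-fromℕ< (s≤s q)))

r*x/R≤x : ∀ {r R} x .{{_ : NonZero R}} → r ≤ R → r * x / R ≤ x
r*x/R≤x {r} {R} x r≤R =
  ≤-trans (/-monoˡ-≤ R (≤-trans (*-monoˡ-≤ x r≤R) (≤-reflexive (*-comm R x)))) (≤-reflexive (m*n/n≡m x R))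

r*x/R<x : ∀ {r R x} .{{_ : NonZero R}} .{{_ : NonZero x}} → r < R → r * x / R < x
r*x/R<x {r} {R} {x} r<R = m<n*o⇒m/o<n (<-≤-trans (*-monoˡ-< x r<R) (≤-reflexive (*-comm R x)))

r*x/R-strict : ∀ {r₁ r₂ R x} .{{_ : NonZero R}} → r₁ < r₂ → R ≤ x → r₁ * x / R < r₂ * x / R
r*x/R-strict {r₁} {r₂} {R} {x} r₁<r₂ R≤x = begin-strict
    r₁ * x / R             ≤⟨ /-monoˡ-≤ R (m+n≤o⇒m≤o∸n (r₁ * x) room) ⟩
    (r₂ * x ∸ R) / R       <⟨ n<1+n _ ⟩
    1 + (r₂ * x ∸ R) / R   ≡⟨ sym (m/n≡1+[m∸n]/n (≤-trans (m≤n+m R (r₁ * x)) room)) ⟩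
    r₂ * x / R             ∎
  where
  open ≤-Reasoning
  room : r₁ * x + R ≤ r₂ * x
  room = ≤-trans (+-monoʳ-≤ (r₁ * x) R≤x) (≤-trans (≤-reflexive (+-comm (r₁ * x) x)) (*-monoˡ-≤ x r₁<r₂))

-- An exchange vector lowering the squared type counts

module ExchangeVector {T K : ℕ} (A : Fin T → Fin K → ℕ) (A≤1 : ∀ t k → A t k ≤ 1) where
  open LinearForms A

  -- B bounds N on vectors with entries in {-1, 0, 1}; C bounds ∣ L ⌊r U / R⌋ ∣ for r ≤ R;
  -- V = (2 (C + 1)) ^ K counts the possible values of k ↦ L ⌊r U / R⌋ k, so R = V + 1 roundings collide.
  B C V R : ℕ
  B = K * (T * T)
  C = B + T
  V = (2 * suc C) ^ K
  R = suc V

  Q : (Fin T → ℤ) → ℕ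
  Q u = sumF T (λ t → ∣ u t ∣²)

  N≤B : ∀ u → (∀ t → ∣ u t ∣ ≤ 1) → N u ≤ B
  N≤B u ∣u∣≤1 = sumF≤n*c K (T * T) (λ k → *-mono-≤ (∣L∣≤T k) (∣L∣≤T k))
    where
    ∣L∣≤T : ∀ k → ∣ L u k ∣ ≤ T
    ∣L∣≤T k = ≤-trans (∣L∣≤sumF∣∣ A≤1 u k) (≤-trans (sumF≤n*c T 1 ∣u∣≤1) (≤-reflexive (*-identityʳ T)))

  module _ (ya yb : Fin T → ℕ) where

    up un : Fin T → ℕ
    up t = ya t ∸ yb t
    un t = yb t ∸ ya t

    U : Fin T → ℤ
    U t = + ya t ℤ.- + yb t

    -- U after moving hp t jobs of type t from the first machine to the second and hn t jobs back.
    U′ : (hp hn : Fin T → ℕ) → Fin T → ℤ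
    U′ hp hn t = U t ℤ.- + 2 ℤ.* (+ hp t ℤ.- + hn t)

    record Improvement : Set where
      field
        hp hn : Fin T → ℕ
        hp≤up : ∀ t → hp t ≤ up t
        hn≤un : ∀ t → hn t ≤ un t
        N-≤   : N (U′ hp hn) ≤ N U
        Q-<   : Q (U′ hp hn) < Q U

    improvement : ∀ hp hn → (∀ t → hp t ≤ up t) → (∀ t → hn t ≤ un t) → N (U′ hp hn) ≤ N U →
                  ∀ t₀ → 0 < hp t₀ → hp t₀ < up t₀ → Improvement
    improvement hp hn hp≤ hn≤ N≤ t₀ 0<hp hp<up = record
      { hp = hp ; hn = hn ; hp≤up = hp≤ ; hn≤un = hn≤ ; N-≤ = N≤
      ; Q-< = sumF-mono-< T (λ t → ≤-trans (m≤m+n _ _) (≤-reflexive (identity t))) t₀ strict }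
      where
      identity : ∀ t → ∣ U′ hp hn t ∣² + 4 * (hp t * (up t ∸ hp t) + hn t * (un t ∸ hn t)) ≡ ∣ U t ∣²
      identity t = square-exchange (ya t) (yb t) (hp t) (hn t) (hp≤ t) (hn≤ t)
      positive : 0 < 4 * (hp t₀ * (up t₀ ∸ hp t₀) + hn t₀ * (un t₀ ∸ hn t₀))
      positive = *-monoʳ-< 4 (≤-trans (*-mono-≤ 0<hp (m<n⇒0<n∸m hp<up)) (m≤m+n _ _))
      strict : ∣ U′ hp hn t₀ ∣² < ∣ U t₀ ∣²
      strict = <-≤-trans (m<m+n _ positive) (≤-reflexive (identity t₀))

    R≤up : ∀ t → yb t + R ≤ ya t → R ≤ up t
    R≤up t yb+R≤ya = m+n≤o⇒m≤o∸n R (≤-trans (≤-reflexive (+-comm R (yb t))) yb+R≤ya)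

    U≡+up-+un : ∀ t → U t ≡ + up t ℤ.- + un t
    U≡+up-+un t = +m-+n≡+[m∸n]-+[n∸m] (ya t) (yb t)

    half⁺ half⁻ : Fin T → ℕ
    half⁺ t = up t / 2
    half⁻ t = un t / 2

    ∣U′-half∣≤1 : ∀ t → ∣ U′ half⁺ half⁻ t ∣ ≤ 1
    ∣U′-half∣≤1 t = subst (λ z → ∣ z ∣ ≤ 1) (sym U′-half)
      (≤-trans (∣+m-+n∣≤m⊔n (up t % 2) (un t % 2)) (⊔-lub (≤-pred (m%n<n (up t) 2)) (≤-pred (m%n<n (un t) 2))))
      where
      cancel : ∀ a a′ b b′ → (a ℤ.+ a′ ℤ.* + 2 ℤ.- (b ℤ.+ b′ ℤ.* + 2)) ℤ.- + 2 ℤ.* (a′ ℤ.- b′) ≡ a ℤ.- b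
      cancel = solve-∀
      U′-half : U′ half⁺ half⁻ t ≡ + (up t % 2) ℤ.- + (un t % 2)
      U′-half = trans (cong (λ z → z ℤ.- + 2 ℤ.* (+ half⁺ t ℤ.- + half⁻ t))
                            (trans (U≡+up-+un t) (cong₂ ℤ._-_ (+m≡+[m%n]+[m/n]*n (up t) 2) (+m≡+[m%n]+[m/n]*n (un t) 2))))
                      (cancel (+ (up t % 2)) (+ half⁺ t) (+ (un t % 2)) (+ half⁻ t))

    round remainder : ℕ → Fin T → ℤ
    round     r t = + (r * up t / R) ℤ.- + (r * un t / R)
    remainder r t = + (r * up t % R) ℤ.- + (r * un t % R)

    R*L-round : ∀ r k → + R ℤ.* L (round r) k ≡ + r ℤ.* L U k ℤ.- L (remainder r) k
    R*L-round r k = begin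
        + R ℤ.* L (round r) k
      ≡⟨ sym (L-* (+ R) (round r) k) ⟩
        L (λ t → + R ℤ.* round r t) k
      ≡⟨ L-linear (+ r) (- + 1) U (remainder r) _ pointwise k ⟩
        + r ℤ.* L U k ℤ.+ - + 1 ℤ.* L (remainder r) k
      ≡⟨ sym (as-combination (+ r) (L U k) (L (remainder r) k)) ⟩
        + r ℤ.* L U k ℤ.- L (remainder r) k ∎
      where
      open ≡-Reasoning
      as-combination : ∀ c u v → c ℤ.* u ℤ.- v ≡ c ℤ.* u ℤ.+ - + 1 ℤ.* v
      as-combination = solve-∀
      collect : ∀ c a q b q′ → c ℤ.* (q ℤ.- q′) ≡ (a ℤ.+ q ℤ.* c ℤ.- (b ℤ.+ q′ ℤ.* c)) ℤ.+ - + 1 ℤ.* (a ℤ.- b)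
      collect = solve-∀
      distrib : ∀ c a b → c ℤ.* (a ℤ.- b) ≡ c ℤ.* a ℤ.- c ℤ.* b
      distrib = solve-∀
      r*U : ∀ t → + (r * up t) ℤ.- + (r * un t) ≡ + r ℤ.* U t
      r*U t = sym (trans (cong (+ r ℤ.*_) (U≡+up-+un t))
                         (trans (distrib (+ r) (+ up t) (+ un t)) (sym (cong₂ ℤ._-_ (ℤ.pos-* r (up t)) (ℤ.pos-* r (un t))))))
      pointwise : ∀ t → + R ℤ.* round r t ≡ + r ℤ.* U t ℤ.+ - + 1 ℤ.* remainder r t
      pointwise t =
        trans (collect (+ R) (+ (r * up t % R)) (+ (r * up t / R)) (+ (r * un t % R)) (+ (r * un t / R)))
              (cong (λ z → z ℤ.+ - + 1 ℤ.* remainder r t)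
                    (trans (sym (cong₂ ℤ._-_ (+m≡+[m%n]+[m/n]*n (r * up t) R) (+m≡+[m%n]+[m/n]*n (r * un t) R))) (r*U t)))

    ∣remainder∣≤R : ∀ r t → ∣ remainder r t ∣ ≤ R
    ∣remainder∣≤R r t = ≤-trans (∣+m-+n∣≤m⊔n (r * up t % R) (r * un t % R))
                                (⊔-lub (<⇒≤ (m%n<n (r * up t) R)) (<⇒≤ (m%n<n (r * un t) R)))

    Collision : Set
    Collision = Σ ℕ λ r₁ → Σ ℕ λ r₂ → r₁ < r₂ × r₂ ≤ V × (∀ k → L (round r₁) k ≡ L (round r₂) k)

    module Rounding (∣LU∣≤B : ∀ k → ∣ L U k ∣ ≤ B) where

      ∣L-round∣≤C : ∀ r → r ≤ R → ∀ k → ∣ L (round r) k ∣ ≤ C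
      ∣L-round∣≤C r r≤R k = *-cancelˡ-≤ R (begin
          R * ∣ L (round r) k ∣                       ≡⟨ sym (ℤ.abs-* (+ R) (L (round r) k)) ⟩
          ∣ + R ℤ.* L (round r) k ∣                   ≡⟨ cong ∣_∣ (R*L-round r k) ⟩
          ∣ + r ℤ.* L U k ℤ.- L (remainder r) k ∣     ≤⟨ ℤ.∣i-j∣≤∣i∣+∣j∣ (+ r ℤ.* L U k) (L (remainder r) k) ⟩
          ∣ + r ℤ.* L U k ∣ + ∣ L (remainder r) k ∣   ≤⟨ +-mono-≤ scaled rest ⟩
          R * B + T * R                               ≡⟨ cong (λ z → R * B + z) (*-comm T R) ⟩
          R * B + R * T                               ≡⟨ sym (*-distribˡ-+ R B T) ⟩
          R * C                                       ∎)
        where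
        open ≤-Reasoning
        scaled : ∣ + r ℤ.* L U k ∣ ≤ R * B
        scaled = ≤-trans (≤-reflexive (ℤ.abs-* (+ r) (L U k))) (*-mono-≤ r≤R (∣LU∣≤B k))
        rest : ∣ L (remainder r) k ∣ ≤ T * R
        rest = ≤-trans (∣L∣≤sumF∣∣ A≤1 (remainder r) k) (sumF≤n*c T R (∣remainder∣≤R r))

      bound : ∀ (i : Fin R) k → ∣ L (round (toℕ i)) k ∣ ≤ C
      bound i = ∣L-round∣≤C (toℕ i) (<⇒≤ (toℕ<n i))

      code : Fin R → Fin K → Fin (2 * suc C)
      code i k = encode C (L (round (toℕ i)) k) (bound i k)

      collision : Collision
      collision = from-pigeonhole (pigeonhole (n<1+n V) (funToFin ∘ code))
        where
        from-pigeonhole : (Σ (Fin R) λ i → Σ (Fin R) λ j → i Fin.< j × funToFin (code i) ≡ funToFin (code j)) → Collision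
        from-pigeonhole (i , j , i<j , same) =
          toℕ i , toℕ j , i<j , ≤-pred (toℕ<n j) ,
          λ k → encode-injective C (bound i k) (bound j k) (funToFin-injective (code i) (code j) same k)

      module Kernel {r₁ r₂ : ℕ} (r₁<r₂ : r₁ < r₂) (r₂≤V : r₂ ≤ V)
                    (same-L : ∀ k → L (round r₁) k ≡ L (round r₂) k) where

        kp kn : Fin T → ℕ
        kp t = r₂ * up t / R ∸ r₁ * up t / R
        kn t = r₂ * un t / R ∸ r₁ * un t / R

        monotone : ∀ x → r₁ * x / R ≤ r₂ * x / R
        monotone x = /-monoˡ-≤ R (*-monoˡ-≤ x (<⇒≤ r₁<r₂))

        kernel-difference : ∀ t → + kp t ℤ.- + kn t ≡ + 1 ℤ.* round r₂ t ℤ.+ - + 1 ℤ.* round r₁ t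
        kernel-difference t =
          trans (cong₂ ℤ._-_ (sym (+m-+n≡+[m∸n] (monotone (up t)))) (sym (+m-+n≡+[m∸n] (monotone (un t)))))
                (regroup (+ (r₂ * up t / R)) (+ (r₁ * up t / R)) (+ (r₂ * un t / R)) (+ (r₁ * un t / R)))
          where
          regroup : ∀ a b c d → (a ℤ.- b) ℤ.- (c ℤ.- d) ≡ + 1 ℤ.* (a ℤ.- c) ℤ.+ - + 1 ℤ.* (b ℤ.- d)
          regroup = solve-∀

        L-U′ : ∀ k → L (U′ kp kn) k ≡ L U k
        L-U′ k = begin
            L (U′ kp kn) k
          ≡⟨ L-linear (+ 1) (- + 2) U (λ t → + kp t ℤ.- + kn t) (U′ kp kn) (λ t → as-combination (U t) _) k ⟩
            + 1 ℤ.* L U k ℤ.+ - + 2 ℤ.* L (λ t → + kp t ℤ.- + kn t) k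
          ≡⟨ cong (λ z → + 1 ℤ.* L U k ℤ.+ - + 2 ℤ.* z) L-kernel ⟩
            + 1 ℤ.* L U k ℤ.+ - + 2 ℤ.* (+ 1 ℤ.* L (round r₂) k ℤ.+ - + 1 ℤ.* L (round r₂) k)
          ≡⟨ vanish (L U k) (L (round r₂) k) ⟩
            L U k ∎
          where
          open ≡-Reasoning
          as-combination : ∀ u h → u ℤ.- + 2 ℤ.* h ≡ + 1 ℤ.* u ℤ.+ - + 2 ℤ.* h
          as-combination = solve-∀
          vanish : ∀ u x → + 1 ℤ.* u ℤ.+ - + 2 ℤ.* (+ 1 ℤ.* x ℤ.+ - + 1 ℤ.* x) ≡ u
          vanish = solve-∀
          L-kernel : L (λ t → + kp t ℤ.- + kn t) k ≡ + 1 ℤ.* L (round r₂) k ℤ.+ - + 1 ℤ.* L (round r₂) k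
          L-kernel = trans (L-linear (+ 1) (- + 1) (round r₂) (round r₁) _ kernel-difference k)
                           (cong (λ z → + 1 ℤ.* L (round r₂) k ℤ.+ - + 1 ℤ.* z) (same-L k))

        kp≤up : ∀ t → kp t ≤ up t
        kp≤up t = ≤-trans (m∸n≤m (r₂ * up t / R) (r₁ * up t / R)) (r*x/R≤x (up t) (≤-trans r₂≤V (n≤1+n V)))

        kn≤un : ∀ t → kn t ≤ un t
        kn≤un t = ≤-trans (m∸n≤m (r₂ * un t / R) (r₁ * un t / R)) (r*x/R≤x (un t) (≤-trans r₂≤V (n≤1+n V)))

        improvement-by-kernel : ∀ t₀ → R ≤ up t₀ → Improvement
        improvement-by-kernel t₀ R≤up = improvement kp kn kp≤up kn≤un
          (≤-reflexive (sumF-cong K (λ k → cong ∣_∣² (L-U′ k)))) t₀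
          (m<n⇒0<n∸m (r*x/R-strict r₁<r₂ R≤up))
          (≤-<-trans (m∸n≤m (r₂ * up t₀ / R) (r₁ * up t₀ / R))
                     (r*x/R<x {{_}} {{>-nonZero (<-≤-trans (s≤s z≤n) R≤up)}} (s≤s r₂≤V)))

    -- Either halving U works, or N U is small, and then two of the R roundings ⌊r U / R⌋ differ by a kernel vector.
    improve : ∀ t₀ → yb t₀ + R ≤ ya t₀ → Improvement
    improve t₀ yb+R≤ya with N (U′ half⁺ half⁻) ≤? N U
    ... | yes halving-ok = improvement half⁺ half⁻ (λ t → m/n≤m (up t) 2) (λ t → m/n≤m (un t) 2) halving-ok t₀
          (m≥n⇒m/n>0 2≤up) (m/n<m (up t₀) 2 {{>-nonZero (<-≤-trans (s≤s z≤n) 2≤up)}} (s≤s (s≤s z≤n)))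
      where
      2≤up : 2 ≤ up t₀
      2≤up = ≤-trans (s≤s (m^n>0 (2 * suc C) K)) (R≤up t₀ yb+R≤ya)
    ... | no halving-fails = by-kernel (Rounding.collision ∣LU∣≤B)
      where
      m≤m*m : ∀ m → m ≤ m * m
      m≤m*m zero    = z≤n
      m≤m*m (suc m) = m≤m*n (suc m) (suc m)
      ∣LU∣≤B : ∀ k → ∣ L U k ∣ ≤ B
      ∣LU∣≤B k = ≤-trans (m≤m*m ∣ L U k ∣) (≤-trans (f≤sumF K (λ k → ∣ L U k ∣²) k)
                   (≤-trans (<⇒≤ (≰⇒> halving-fails)) (N≤B (U′ half⁺ half⁻) ∣U′-half∣≤1)))
      by-kernel : Collision → Improvement
      by-kernel (r₁ , r₂ , r₁<r₂ , r₂≤V , same-L) =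
        Rounding.Kernel.improvement-by-kernel ∣LU∣≤B r₁<r₂ r₂≤V same-L t₀ (R≤up t₀ yb+R≤ya)

-- Moving jobs between two machines

rank : ∀ {n} → (Fin n → Bool) → Fin n → ℕ
rank P zero    = 0
rank P (suc j) = ind (P zero) + rank (P ∘ suc) j

count-rank< : ∀ n (P : Fin n → Bool) h → sumF n (λ j → ind (P j) * ind (rank P j <ᵇ h)) ≡ h ⊓ count P
count-rank< zero    P h = sym (⊓-zeroʳ h)
count-rank< (suc n) P h with P zero
count-rank< (suc n) P zero    | true  = trans (sumF-cong n (λ j → *-zeroʳ (ind (P (suc j))))) (sumF-zero n)
count-rank< (suc n) P (suc h) | true  = cong suc (count-rank< n (P ∘ suc) h)
count-rank< (suc n) P h       | false = count-rank< n (P ∘ suc) h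

module _ {m : ℕ} (a b : Fin m) where

  choose : Bool → Bool → Fin m → Fin m
  choose true  _     _ = b
  choose false true  _ = a
  choose false false x = x

  Guarded : Bool → Bool → Fin m → Set
  Guarded p q x = (p ≡ true → x ≡ a) × (q ≡ true → x ≡ b)

  choose-a : a ≢ b → ∀ p q x → Guarded p q x → [ choose p q x ≟ a ] + ind p ≡ [ x ≟ a ] + ind q
  choose-a a≢b true  true  x (⇒a , ⇒b) = ⊥-elim (a≢b (trans (sym (⇒a refl)) (⇒b refl)))
  choose-a a≢b true  false x (⇒a , _)  rewrite ⇒a refl | [≟]-≢ (a≢b ∘ sym) | [≟]-refl a = refl
  choose-a a≢b false true  x (_ , ⇒b)  rewrite ⇒b refl | [≟]-≢ (a≢b ∘ sym) | [≟]-refl a = refl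
  choose-a a≢b false false x _         = refl

  choose-b : a ≢ b → ∀ p q x → Guarded p q x → [ choose p q x ≟ b ] + ind q ≡ [ x ≟ b ] + ind p
  choose-b a≢b true  true  x (⇒a , ⇒b) = ⊥-elim (a≢b (trans (sym (⇒a refl)) (⇒b refl)))
  choose-b a≢b true  false x (⇒a , _)  rewrite ⇒a refl | [≟]-≢ a≢b | [≟]-refl b = refl
  choose-b a≢b false true  x (_ , ⇒b)  rewrite ⇒b refl | [≟]-≢ a≢b | [≟]-refl b = refl
  choose-b a≢b false false x _         = refl

  choose-other : a ≢ b → ∀ p q x → Guarded p q x → ∀ {i} → i ≢ a → i ≢ b → [ choose p q x ≟ i ] ≡ [ x ≟ i ]
  choose-other a≢b true  true  x (⇒a , ⇒b) _ _ = ⊥-elim (a≢b (trans (sym (⇒a refl)) (⇒b refl)))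
  choose-other a≢b true  false x (⇒a , _)  i≢a i≢b rewrite ⇒a refl | [≟]-≢ (i≢b ∘ sym) | [≟]-≢ (i≢a ∘ sym) = refl
  choose-other a≢b false true  x (_ , ⇒b)  i≢a i≢b rewrite ⇒b refl | [≟]-≢ (i≢b ∘ sym) | [≟]-≢ (i≢a ∘ sym) = refl
  choose-other a≢b false false x _         _ _ = refl

does-∧-true : ∀ {m} {x y : Fin m} {c} → does (x ≟ y) ∧ c ≡ true → x ≡ y
does-∧-true {x = x} {y} eq with x ≟ y
... | yes x≡y = x≡y

module Transfer {m : ℕ} {f g : Fin m → ℕ} {a b : Fin m} (a≢b : a ≢ b)
                (agree : ∀ i → i ≢ a → i ≢ b → f i ≡ g i) (balanced : f a + f b ≡ g a + g b) where

  sumF-transfer : sumF m f ≡ sumF m g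
  sumF-transfer = +-cancelʳ-≡ (g a + g b) _ _ (begin
      sumF m f + (g a + g b)   ≡⟨ sym (+-assoc (sumF m f) (g a) (g b)) ⟩
      sumF m f + g a + g b     ≡⟨ sumF-update₂ m a≢b f g agree ⟩
      sumF m g + f a + f b     ≡⟨ +-assoc (sumF m g) (f a) (f b) ⟩
      sumF m g + (f a + f b)   ≡⟨ cong (_+_ (sumF m g)) balanced ⟩
      sumF m g + (g a + g b)   ∎)
    where open ≡-Reasoning

  squares-transfer : 2 * sumF m (λ i → g i * g i) + ∣ + f a ℤ.- + f b ∣²
                   ≡ 2 * sumF m (λ i → f i * f i) + ∣ + g a ℤ.- + g b ∣²
  squares-transfer = ℤ.+-injective (begin
      + (2 * Y + ∣ + f a ℤ.- + f b ∣²)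
    ≡⟨ embed Y (f a) (f b) ⟩
      + 2 ℤ.* + Y ℤ.+ (+ f a ℤ.- + f b) ℤ.* (+ f a ℤ.- + f b)
    ≡⟨ polarise (+ Y) (+ f a) (+ f b) ⟩
      + 2 ℤ.* (+ Y ℤ.+ + f a ℤ.* + f a ℤ.+ + f b ℤ.* + f b) ℤ.- (+ f a ℤ.+ + f b) ℤ.* (+ f a ℤ.+ + f b)
    ≡⟨ cong₂ (λ u v → + 2 ℤ.* u ℤ.- v ℤ.* v) squares totals ⟩
      + 2 ℤ.* (+ X ℤ.+ + g a ℤ.* + g a ℤ.+ + g b ℤ.* + g b) ℤ.- (+ g a ℤ.+ + g b) ℤ.* (+ g a ℤ.+ + g b)
    ≡⟨ sym (polarise (+ X) (+ g a) (+ g b)) ⟩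
      + 2 ℤ.* + X ℤ.+ (+ g a ℤ.- + g b) ℤ.* (+ g a ℤ.- + g b)
    ≡⟨ sym (embed X (g a) (g b)) ⟩
      + (2 * X + ∣ + g a ℤ.- + g b ∣²) ∎)
    where
    open ≡-Reasoning
    X Y : ℕ
    X = sumF m (λ i → f i * f i)
    Y = sumF m (λ i → g i * g i)
    -- (x - y)² = 2 (x² + y²) - (x + y)², and x + y is the same for f and g.
    polarise : ∀ s x y → + 2 ℤ.* s ℤ.+ (x ℤ.- y) ℤ.* (x ℤ.- y)
                       ≡ + 2 ℤ.* (s ℤ.+ x ℤ.* x ℤ.+ y ℤ.* y) ℤ.- (x ℤ.+ y) ℤ.* (x ℤ.+ y)
    polarise = solve-∀
    embed : ∀ s x y → + (2 * s + ∣ + x ℤ.- + y ∣²) ≡ + 2 ℤ.* + s ℤ.+ (+ x ℤ.- + y) ℤ.* (+ x ℤ.- + y)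
    embed s x y = trans (ℤ.pos-+ (2 * s) _) (cong₂ ℤ._+_ (ℤ.pos-* 2 s) (+∣i∣²≡i*i (+ x ℤ.- + y)))
    embed₃ : ∀ s x y → + (s + x * x + y * y) ≡ + s ℤ.+ + x ℤ.* + x ℤ.+ + y ℤ.* + y
    embed₃ s x y = trans (ℤ.pos-+ (s + x * x) (y * y))
                         (cong₂ ℤ._+_ (trans (ℤ.pos-+ s (x * x)) (cong (λ z → + s ℤ.+ z) (ℤ.pos-* x x))) (ℤ.pos-* y y))
    squares : + Y ℤ.+ + f a ℤ.* + f a ℤ.+ + f b ℤ.* + f b ≡ + X ℤ.+ + g a ℤ.* + g a ℤ.+ + g b ℤ.* + g b
    squares = trans (sym (embed₃ Y (f a) (f b)))
                    (trans (cong +_ (sym (sumF-update₂ m a≢b (λ i → f i * f i) (λ i → g i * g i)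
                                            (λ i i≢a i≢b → cong (λ z → z * z) (agree i i≢a i≢b)))))
                           (embed₃ X (g a) (g b)))
    totals : + f a ℤ.+ + f b ≡ + g a ℤ.+ + g b
    totals = trans (sym (ℤ.pos-+ (f a) (f b))) (trans (cong +_ balanced) (ℤ.pos-+ (g a) (g b)))

  triangular-transfer : 4 * sumF m (triangular ∘ g) + ∣ + f a ℤ.- + f b ∣²
                      ≡ 4 * sumF m (triangular ∘ f) + ∣ + g a ℤ.- + g b ∣²
  triangular-transfer = begin
      4 * sumF m (triangular ∘ g) + ∣ + f a ℤ.- + f b ∣²
    ≡⟨ cong (_+ ∣ + f a ℤ.- + f b ∣²) (4*sumF-triangular g) ⟩
      2 * sumF m (λ i → g i * g i) + 2 * sumF m g + ∣ + f a ℤ.- + f b ∣²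
    ≡⟨ +-CS.xy∙z≈xz∙y (2 * sumF m (λ i → g i * g i)) (2 * sumF m g) _ ⟩
      2 * sumF m (λ i → g i * g i) + ∣ + f a ℤ.- + f b ∣² + 2 * sumF m g
    ≡⟨ cong₂ _+_ squares-transfer (cong (2 *_) (sym sumF-transfer)) ⟩
      2 * sumF m (λ i → f i * f i) + ∣ + g a ℤ.- + g b ∣² + 2 * sumF m f
    ≡⟨ +-CS.xy∙z≈xz∙y (2 * sumF m (λ i → f i * f i)) _ (2 * sumF m f) ⟩
      2 * sumF m (λ i → f i * f i) + 2 * sumF m f + ∣ + g a ℤ.- + g b ∣²
    ≡⟨ cong (_+ ∣ + g a ℤ.- + g b ∣²) (sym (4*sumF-triangular f)) ⟩
      4 * sumF m (triangular ∘ f) + ∣ + g a ℤ.- + g b ∣² ∎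
    where
    open ≡-Reasoning
    4*sumF-triangular : ∀ h → 4 * sumF m (triangular ∘ h) ≡ 2 * sumF m (λ i → h i * h i) + 2 * sumF m h
    4*sumF-triangular h = begin
        4 * sumF m (triangular ∘ h)                              ≡⟨ *-distribˡ-sumF m 4 _ ⟩
        sumF m (λ i → 4 * triangular (h i))                      ≡⟨ sumF-cong m (λ i → doubled (h i)) ⟩
        sumF m (λ i → 2 * (h i * h i) + 2 * h i)                 ≡⟨ sumF-distrib-+ m _ _ ⟩
        sumF m (λ i → 2 * (h i * h i)) + sumF m (λ i → 2 * h i)  ≡⟨ sym (cong₂ _+_ (*-distribˡ-sumF m 2 _) (*-distribˡ-sumF m 2 h)) ⟩
        2 * sumF m (λ i → h i * h i) + 2 * sumF m h              ∎
      where
      doubled : ∀ x → 4 * triangular x ≡ 2 * (x * x) + 2 * x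
      doubled x = trans (*-assoc 2 2 (triangular x)) (trans (cong (2 *_) (2*triangular x)) (*-distribˡ-+ 2 (x * x) x))

module Reassignment {n m K : ℕ} (S : Fin K → Subset n) (φ : Fin n → Fin m) {a b : Fin m} (a≢b : a ≢ b)
  (hp hn : Type K → ℕ) (hp≤ : ∀ t → hp t ≤ typeCount S φ a t) (hn≤ : ∀ t → hn t ≤ typeCount S φ b t) where

  ofType : Fin m → Type K → Fin n → Bool
  ofType i t j = does (type S j ≟ t) ∧ does (φ j ≟ i)

  leaves : Fin m → (Type K → ℕ) → Fin n → Bool
  leaves i h j = does (φ j ≟ i) ∧ (rank (ofType i (type S j)) j <ᵇ h (type S j))

  φ′ : Fin n → Fin m
  φ′ j = choose a b (leaves a hp j) (leaves b hn j) (φ j)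

  guarded : ∀ j → Guarded a b (leaves a hp j) (leaves b hn j) (φ j)
  guarded j = does-∧-true , does-∧-true

  count-leaves : ∀ i h → (∀ t → h t ≤ typeCount S φ i t) → ∀ t →
    sumF n (λ j → [ type S j ≟ t ] * ind (leaves i h j)) ≡ h t
  count-leaves i h h≤ t = begin
      sumF n (λ j → [ type S j ≟ t ] * ind (leaves i h j))
    ≡⟨ sumF-cong n on-type ⟩
      sumF n (λ j → ind (ofType i t j) * ind (rank (ofType i t) j <ᵇ h t))
    ≡⟨ count-rank< n (ofType i t) (h t) ⟩
      h t ⊓ count (ofType i t)
    ≡⟨ cong (h t ⊓_) (sumF-cong n (λ j → ind-∧ (does (type S j ≟ t)) (does (φ j ≟ i)))) ⟩
      h t ⊓ typeCount S φ i t
    ≡⟨ m≤n⇒m⊓n≡m (h≤ t) ⟩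
      h t ∎
    where
    open ≡-Reasoning
    on-type : ∀ j → [ type S j ≟ t ] * ind (leaves i h j) ≡ ind (ofType i t j) * ind (rank (ofType i t) j <ᵇ h t)
    on-type j with type S j ≟ t
    ... | no _     = refl
    ... | yes refl = trans (+-identityʳ _) (ind-∧ (does (φ j ≟ i)) _)

  typeCount-a : ∀ t → typeCount S φ′ a t + hp t ≡ typeCount S φ a t + hn t
  typeCount-a t = begin
      typeCount S φ′ a t + hp t
    ≡⟨ cong (_+_ (typeCount S φ′ a t)) (sym (count-leaves a hp hp≤ t)) ⟩
      typeCount S φ′ a t + sumF n (λ j → [ type S j ≟ t ] * ind (leaves a hp j))
    ≡⟨ weighted-sum-+ n (λ j → [ type S j ≟ t ]) _ _ _ _ (λ j → choose-a a b a≢b _ _ (φ j) (guarded j)) ⟩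
      typeCount S φ a t + sumF n (λ j → [ type S j ≟ t ] * ind (leaves b hn j))
    ≡⟨ cong (_+_ (typeCount S φ a t)) (count-leaves b hn hn≤ t) ⟩
      typeCount S φ a t + hn t ∎
    where open ≡-Reasoning

  typeCount-b : ∀ t → typeCount S φ′ b t + hn t ≡ typeCount S φ b t + hp t
  typeCount-b t = begin
      typeCount S φ′ b t + hn t
    ≡⟨ cong (_+_ (typeCount S φ′ b t)) (sym (count-leaves b hn hn≤ t)) ⟩
      typeCount S φ′ b t + sumF n (λ j → [ type S j ≟ t ] * ind (leaves b hn j))
    ≡⟨ weighted-sum-+ n (λ j → [ type S j ≟ t ]) _ _ _ _ (λ j → choose-b a b a≢b _ _ (φ j) (guarded j)) ⟩
      typeCount S φ b t + sumF n (λ j → [ type S j ≟ t ] * ind (leaves a hp j))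
    ≡⟨ cong (_+_ (typeCount S φ b t)) (count-leaves a hp hp≤ t) ⟩
      typeCount S φ b t + hp t ∎
    where open ≡-Reasoning

  typeCount-other : ∀ {i} → i ≢ a → i ≢ b → ∀ t → typeCount S φ′ i t ≡ typeCount S φ i t
  typeCount-other i≢a i≢b t =
    sumF-cong n (λ j → cong ([ type S j ≟ t ] *_) (choose-other a b a≢b _ _ (φ j) (guarded j) i≢a i≢b))

  typeCount-total : ∀ t → typeCount S φ a t + typeCount S φ b t ≡ typeCount S φ′ a t + typeCount S φ′ b t
  typeCount-total t = +-cancelʳ-≡ (hp t + hn t) _ _ (begin
      ya t + yb t + (hp t + hn t)     ≡⟨ cong (_+_ (ya t + yb t)) (+-comm (hp t) (hn t)) ⟩
      ya t + yb t + (hn t + hp t)     ≡⟨ +-CS.interchange (ya t) (yb t) (hn t) (hp t) ⟩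
      ya t + hn t + (yb t + hp t)     ≡⟨ sym (cong₂ _+_ (typeCount-a t) (typeCount-b t)) ⟩
      ya′ t + hp t + (yb′ t + hn t)   ≡⟨ +-CS.interchange (ya′ t) (hp t) (yb′ t) (hn t) ⟩
      ya′ t + yb′ t + (hp t + hn t)   ∎)
    where
    open ≡-Reasoning
    ya yb ya′ yb′ : Type K → ℕ
    ya  = typeCount S φ a
    yb  = typeCount S φ b
    ya′ = typeCount S φ′ a
    yb′ = typeCount S φ′ b

  typeCount-difference : ∀ t → + typeCount S φ′ a t ℤ.- + typeCount S φ′ b t
                             ≡ (+ typeCount S φ a t ℤ.- + typeCount S φ b t) ℤ.- + 2 ℤ.* (+ hp t ℤ.- + hn t)
  typeCount-difference t = sym (trans
    (cong₂ (λ y z → (y ℤ.- z) ℤ.- + 2 ℤ.* (+ hp t ℤ.- + hn t))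
           (+-solve {typeCount S φ′ a t} {hp t} {typeCount S φ a t} {hn t} (typeCount-a t))
           (+-solve {typeCount S φ′ b t} {hn t} {typeCount S φ b t} {hp t} (typeCount-b t)))
    (cancel (+ typeCount S φ′ a t) (+ typeCount S φ′ b t) (+ hp t) (+ hn t)))
    where
    cancel : ∀ x y p q → ((x ℤ.+ p ℤ.- q) ℤ.- (y ℤ.+ q ℤ.- p)) ℤ.- + 2 ℤ.* (p ℤ.- q) ≡ x ℤ.- y
    cancel = solve-∀

  load-transfer : ∀ k → 4 * sumF m (λ i → triangular (load S φ′ i k)) + ∣ + load S φ a k ℤ.- + load S φ b k ∣²
                      ≡ 4 * sumF m (λ i → triangular (load S φ i k)) + ∣ + load S φ′ a k ℤ.- + load S φ′ b k ∣²
  load-transfer k = Transfer.triangular-transfer a≢b agree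
    (weighted-sum-+ (2 ^ K) (λ t → occurs t k) _ _ _ _ typeCount-total)
    where
    agree : ∀ i → i ≢ a → i ≢ b → load S φ i k ≡ load S φ′ i k
    agree i i≢a i≢b = sumF-cong (2 ^ K) (λ t → cong (occurs t k *_) (sym (typeCount-other i≢a i≢b t)))

  typeCount-transfer : ∀ t →
    2 * sumF m (λ i → typeCount S φ′ i t * typeCount S φ′ i t) + ∣ + typeCount S φ a t ℤ.- + typeCount S φ b t ∣²
      ≡ 2 * sumF m (λ i → typeCount S φ i t * typeCount S φ i t) + ∣ + typeCount S φ′ a t ℤ.- + typeCount S φ′ b t ∣²
  typeCount-transfer t =
    Transfer.squares-transfer a≢b (λ i i≢a i≢b → sym (typeCount-other i≢a i≢b t)) (typeCount-total t)

module _ {n m K : ℕ} (S : Fin K → Subset n) where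
  open LinearForms (occurs {K})
  open ExchangeVector (occurs {K}) occurs≤1

  typeSpread : (Fin n → Fin m) → ℕ
  typeSpread φ = sumF (2 ^ K) (λ t → sumF m (λ i → typeCount S φ i t * typeCount S φ i t))

  typeSpread-cong : ∀ {φ ψ} → (∀ i t → typeCount S φ i t ≡ typeCount S ψ i t) → typeSpread φ ≡ typeSpread ψ
  typeSpread-cong same = sumF-cong (2 ^ K) (λ t → sumF-cong m (λ i → cong₂ _*_ (same i t) (same i t)))

  improving-move : ∀ φ {a b : Fin m} → a ≢ b → ∀ t₀ → typeCount S φ b t₀ + R ≤ typeCount S φ a t₀ →
    Σ (Fin n → Fin m) λ φ′ → cost S φ′ ≤ cost S φ × typeSpread φ′ < typeSpread φ
  improving-move φ {a} {b} a≢b t₀ gap = φ′ , cost-≤ , spread-<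
    where
    ya yb : Type K → ℕ
    ya = typeCount S φ a
    yb = typeCount S φ b
    open Improvement (improve ya yb t₀ gap)
    open Reassignment S φ a≢b hp hn (λ t → ≤-trans (hp≤up t) (m∸n≤m (ya t) (yb t)))
                                    (λ t → ≤-trans (hn≤un t) (m∸n≤m (yb t) (ya t)))

    -- Summed over scenarios, load-transfer reads 4 cost φ′ + N U ≡ 4 cost φ + N U′.
    cost-≤ : cost S φ′ ≤ cost S φ
    cost-≤ = cancel-≤ 4 (sumF-identity K 4 _ _ _ _ λ k →
      subst₂ (λ u v → 4 * sumF m (λ i → triangular (load S φ′ i k)) + ∣ u ∣²
                    ≡ 4 * sumF m (λ i → triangular (load S φ i k)) + ∣ v ∣²)
             (L-diff ya yb k) (trans (L-diff (typeCount S φ′ a) (typeCount S φ′ b) k) (L-cong typeCount-difference k))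
             (load-transfer k)) N-≤

    spread-< : typeSpread φ′ < typeSpread φ
    spread-< = cancel-< 2 (sumF-identity (2 ^ K) 2 _ _ _ _ λ t →
      subst (λ v → 2 * sumF m (λ i → typeCount S φ′ i t * typeCount S φ′ i t) + ∣ U ya yb t ∣²
                 ≡ 2 * sumF m (λ i → typeCount S φ i t * typeCount S φ i t) + ∣ v ∣²)
            (typeCount-difference t) (typeCount-transfer t)) Q-<

-- Swapping two jobs of the same type

module _ {n m K : ℕ} (S : Fin K → Subset n) where

  prefixSquares : (Fin n → Fin m) → ℕ → ℕ
  prefixSquares φ J = sumF (2 ^ K) (λ t → sumF m (λ i → prefixTypeCount S φ i t J * prefixTypeCount S φ i t J))

  prefixSpread : (Fin n → Fin m) → ℕ
  prefixSpread φ = sumF (suc n) (λ J → prefixSquares φ (toℕ J))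

  prefixSpread-cong : ∀ {φ ψ} → (∀ j → φ j ≡ ψ j) → prefixSpread φ ≡ prefixSpread ψ
  prefixSpread-cong φ≗ψ = sumF-cong (suc n) λ J → sumF-cong (2 ^ K) λ t → sumF-cong m λ i →
    cong₂ _*_ (prefixTypeCount-cong S φ≗ψ i t (toℕ J)) (prefixTypeCount-cong S φ≗ψ i t (toℕ J))

module Swap {n m K : ℕ} (S : Fin K → Subset n) (φ : Fin n → Fin m) {x₁ x₂ : Fin n} {a b : Fin m} {t : Type K}
            (x₁≢x₂ : x₁ ≢ x₂) (a≢b : a ≢ b) (type₁ : type S x₁ ≡ t) (type₂ : type S x₂ ≡ t)
            (φ₁ : φ x₁ ≡ a) (φ₂ : φ x₂ ≡ b) where

  φ″ : Fin n → Fin m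
  φ″ j = if does (j ≟ x₁) then b else if does (j ≟ x₂) then a else φ j

  private
    pc pc″ : Fin m → Type K → ℕ → ℕ
    pc  = prefixTypeCount S φ
    pc″ = prefixTypeCount S φ″

    term : (Fin n → Fin m) → Fin m → Type K → ℕ → Fin n → ℕ
    term ψ i t′ J j = [ type S j ≟ t′ ] * ([ ψ j ≟ i ] * before J j)

    φ″₁ : φ″ x₁ ≡ b
    φ″₁ rewrite dec-true (x₁ ≟ x₁) refl = refl
    φ″₂ : φ″ x₂ ≡ a
    φ″₂ rewrite dec-false (x₂ ≟ x₁) (x₁≢x₂ ∘ sym) | dec-true (x₂ ≟ x₂) refl = refl

  exchanged : ∀ i t′ J → pc″ i t′ J + [ t ≟ t′ ] * ([ a ≟ i ] * before J x₁) + [ t ≟ t′ ] * ([ b ≟ i ] * before J x₂)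
                       ≡ pc i t′ J + [ t ≟ t′ ] * ([ b ≟ i ] * before J x₁) + [ t ≟ t′ ] * ([ a ≟ i ] * before J x₂)
  exchanged i t′ J = begin
      pc″ i t′ J + at a x₁ + at b x₂
    ≡⟨ cong₂ (λ u v → pc″ i t′ J + u + v) (sym (term-at φ type₁ φ₁)) (sym (term-at φ type₂ φ₂)) ⟩
      pc″ i t′ J + term φ i t′ J x₁ + term φ i t′ J x₂
    ≡⟨ sym (sumF-update₂ n x₁≢x₂ (term φ i t′ J) (term φ″ i t′ J) agree) ⟩
      pc i t′ J + term φ″ i t′ J x₁ + term φ″ i t′ J x₂
    ≡⟨ cong₂ (λ u v → pc i t′ J + u + v) (term-at φ″ type₁ φ″₁) (term-at φ″ type₂ φ″₂) ⟩
      pc i t′ J + at b x₁ + at a x₂ ∎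
    where
    open ≡-Reasoning
    at : Fin m → Fin n → ℕ
    at c x = [ t ≟ t′ ] * ([ c ≟ i ] * before J x)
    term-at : ∀ ψ {x c} → type S x ≡ t → ψ x ≡ c → term ψ i t′ J x ≡ at c x
    term-at ψ refl refl = refl
    agree : ∀ j → j ≢ x₁ → j ≢ x₂ → term φ i t′ J j ≡ term φ″ i t′ J j
    agree j j≢x₁ j≢x₂ rewrite dec-false (j ≟ x₁) j≢x₁ | dec-false (j ≟ x₂) j≢x₂ = refl

  unchanged : ∀ J → before J x₂ ≡ before J x₁ → ∀ i t′ → pc″ i t′ J ≡ pc i t′ J
  unchanged J same i t′ = cancel (subst (λ β → pc″ i t′ J + p + [ t ≟ t′ ] * ([ b ≟ i ] * β)
                                             ≡ pc i t′ J + q + [ t ≟ t′ ] * ([ a ≟ i ] * β)) same (exchanged i t′ J))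
    where
    p q : ℕ
    p = [ t ≟ t′ ] * ([ a ≟ i ] * before J x₁)
    q = [ t ≟ t′ ] * ([ b ≟ i ] * before J x₁)
    cancel : pc″ i t′ J + p + q ≡ pc i t′ J + q + p → pc″ i t′ J ≡ pc i t′ J
    cancel eq = +-cancelʳ-≡ (p + q) _ _ (trans (sym (+-assoc (pc″ i t′ J) p q))
                  (trans eq (trans (+-assoc (pc i t′ J) q p) (cong (_+_ (pc i t′ J)) (+-comm q p)))))

  moved : ∀ J → toℕ x₁ < J → J ≤ toℕ x₂ → ∀ i t′ → pc″ i t′ J + [ t ≟ t′ ] * [ a ≟ i ] ≡ pc i t′ J + [ t ≟ t′ ] * [ b ≟ i ]
  moved J x₁<J J≤x₂ i t′ = trans (sym (simplify (pc″ i t′ J) [ t ≟ t′ ] [ a ≟ i ] [ b ≟ i ]))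
    (trans (subst₂ (λ β₁ β₂ → pc″ i t′ J + [ t ≟ t′ ] * ([ a ≟ i ] * β₁) + [ t ≟ t′ ] * ([ b ≟ i ] * β₂)
                            ≡ pc i t′ J + [ t ≟ t′ ] * ([ b ≟ i ] * β₁) + [ t ≟ t′ ] * ([ a ≟ i ] * β₂))
                   (before-< x₁ x₁<J) (before-≥ x₂ J≤x₂) (exchanged i t′ J))
           (simplify (pc i t′ J) [ t ≟ t′ ] [ b ≟ i ] [ a ≟ i ]))
    where
    simplify : ∀ x p q r → x + p * (q * 1) + p * (r * 0) ≡ x + p * q
    simplify x p q r = trans (cong₂ (λ u v → x + p * u + v) (*-identityʳ q) (trans (cong (p *_) (*-zeroʳ r)) (*-zeroʳ p)))
                             (+-identityʳ _)

  typeCount-swap : ∀ i t′ → typeCount S φ″ i t′ ≡ typeCount S φ i t′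
  typeCount-swap i t′ = trans (sym (prefixTypeCount-all S φ″ i t′))
    (trans (unchanged n (trans (before-< x₂ (toℕ<n x₂)) (sym (before-< x₁ (toℕ<n x₁)))) i t′)
           (prefixTypeCount-all S φ i t′))

  module InRange {J : ℕ} (x₁<J : toℕ x₁ < J) (J≤x₂ : J ≤ toℕ x₂) (gap : pc b t J + 2 ≤ pc a t J) where

    a-drops : pc a t J ≡ suc (pc″ a t J)
    a-drops = sym (trans (+-comm 1 _) (trans (subst₂ (λ u v → pc″ a t J + u ≡ pc a t J + v)
                (cong₂ _*_ ([≟]-refl t) ([≟]-refl a)) (cong₂ _*_ ([≟]-refl t) ([≟]-≢ (a≢b ∘ sym))) (moved J x₁<J J≤x₂ a t))
                (+-identityʳ _)))

    b-rises : pc″ b t J ≡ suc (pc b t J)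
    b-rises = trans (sym (+-identityʳ _)) (trans (subst₂ (λ u v → pc″ b t J + u ≡ pc b t J + v)
                (cong₂ _*_ ([≟]-refl t) ([≟]-≢ a≢b)) (cong₂ _*_ ([≟]-refl t) ([≟]-refl b)) (moved J x₁<J J≤x₂ b t))
                (+-comm _ 1))

    others : ∀ i → i ≢ a → i ≢ b → pc i t J ≡ pc″ i t J
    others i i≢a i≢b = sym (+-cancelʳ-≡ 0 _ _ (subst₂ (λ u v → pc″ i t J + u ≡ pc i t J + v)
                         (vanish (i≢a ∘ sym)) (vanish (i≢b ∘ sym)) (moved J x₁<J J≤x₂ i t)))
      where
      vanish : ∀ {c} → c ≢ i → [ t ≟ t ] * [ c ≟ i ] ≡ 0
      vanish c≢i = trans (cong ([ t ≟ t ] *_) ([≟]-≢ c≢i)) (*-zeroʳ [ t ≟ t ])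

    squares-< : sumF m (λ i → pc″ i t J * pc″ i t J) < sumF m (λ i → pc i t J * pc i t J)
    squares-< = cancel-< 2 (Transfer.squares-transfer a≢b others balanced) closer
      where
      balanced : pc a t J + pc b t J ≡ pc″ a t J + pc″ b t J
      balanced = trans (cong (_+ pc b t J) a-drops) (trans (sym (+-suc _ _)) (cong (_+_ (pc″ a t J)) (sym b-rises)))
      shrink : ∀ x y → suc y ≤ x → ∣ + x ℤ.- + suc y ∣² < ∣ + suc x ℤ.- + y ∣²
      shrink x y y<x rewrite +m-+n≡+[m∸n] y<x | +m-+n≡+[m∸n] (≤-trans (n≤1+n y) (≤-trans y<x (n≤1+n x))) =
        *-mono-< smaller smaller
        where
        smaller : x ∸ suc y < suc x ∸ y
        smaller = ≤-<-trans (∸-monoʳ-≤ x (n≤1+n y))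
                            (≤-reflexive (sym (+-∸-assoc 1 (≤-trans (n≤1+n y) y<x))))
      closer : ∣ + pc″ a t J ℤ.- + pc″ b t J ∣² < ∣ + pc a t J ℤ.- + pc b t J ∣²
      closer = subst₂ (λ u v → ∣ + pc″ a t J ℤ.- + u ∣² < ∣ + v ℤ.- + pc b t J ∣²) (sym b-rises) (sym a-drops)
                 (shrink (pc″ a t J) (pc b t J)
                   (≤-pred (≤-trans (≤-reflexive (+-comm 2 (pc b t J))) (≤-trans gap (≤-reflexive a-drops)))))

    prefixSquares-< : prefixSquares S φ″ J < prefixSquares S φ J
    prefixSquares-< = sumF-mono-< (2 ^ K) elsewhere t squares-<
      where
      elsewhere : ∀ t′ → sumF m (λ i → pc″ i t′ J * pc″ i t′ J) ≤ sumF m (λ i → pc i t′ J * pc i t′ J)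
      elsewhere t′ with t ≟ t′
      ... | yes refl = <⇒≤ squares-<
      ... | no t≢t′ = ≤-reflexive (sumF-cong m (λ i → cong (λ z → z * z)
                        (+-cancelʳ-≡ 0 _ _ (subst₂ (λ u v → pc″ i t′ J + u ≡ pc i t′ J + v)
                           (vanish t≢t′) (vanish t≢t′) (moved J x₁<J J≤x₂ i t′)))))
        where
        vanish : t ≢ t′ → ∀ {c} → [ t ≟ t′ ] * c ≡ 0
        vanish t≢t′ = cong (_* _) ([≟]-≢ t≢t′)

  module _ (x₁<x₂ : toℕ x₁ < toℕ x₂)
           (gap : ∀ J → toℕ x₁ < J → J ≤ toℕ x₂ → pc b t J + 2 ≤ pc a t J) where

    same-squares : ∀ {J} → before J x₂ ≡ before J x₁ → prefixSquares S φ″ J ≡ prefixSquares S φ J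
    same-squares {J} same = sumF-cong (2 ^ K) (λ t′ → sumF-cong m (λ i → cong (λ z → z * z) (unchanged J same i t′)))

    prefixSquares-≤ : ∀ J → prefixSquares S φ″ J ≤ prefixSquares S φ J
    prefixSquares-≤ J with toℕ x₁ <? J | J ≤? toℕ x₂
    ... | yes x₁<J | yes J≤x₂ = <⇒≤ (InRange.prefixSquares-< x₁<J J≤x₂ (gap J x₁<J J≤x₂))
    ... | no  J≤x₁ | _        = ≤-reflexive (same-squares {J} (trans (before-≥ x₂ (≤-trans (≮⇒≥ J≤x₁) (<⇒≤ x₁<x₂)))
                                                                 (sym (before-≥ x₁ (≮⇒≥ J≤x₁)))))
    ... | yes x₁<J | no x₂<J  = ≤-reflexive (same-squares {J} (trans (before-< x₂ (≰⇒> x₂<J)) (sym (before-< x₁ x₁<J))))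

    prefixSpread-< : prefixSpread S φ″ < prefixSpread S φ
    prefixSpread-< = sumF-mono-< (suc n) (λ J → prefixSquares-≤ (toℕ J)) (inject₁ x₂)
      (subst (λ J → prefixSquares S φ″ J < prefixSquares S φ J) (sym (toℕ-inject₁ x₂))
             (InRange.prefixSquares-< x₁<x₂ ≤-refl (gap (toℕ x₂) x₁<x₂ ≤-refl)))

-- The lexicographic optimum

module Optimum {n m′ K : ℕ} (S : Fin K → Subset n) where
  open ExchangeVector (occurs {K}) occurs≤1 using (V; R)

  m : ℕ
  m = suc m′

  W : ℕ
  W = suc (suc n * (2 ^ K * (m * (n * n))))

  typeSpread<W : ∀ (ψ : Fin n → Fin m) → typeSpread S ψ < W
  typeSpread<W ψ = s≤s (≤-trans (sumF≤n*c (2 ^ K) (m * (n * n)) λ t → sumF≤n*c m (n * n) λ i →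
                                   *-mono-≤ (typeCount≤n S ψ i t) (typeCount≤n S ψ i t))
                                 (m≤n*m (2 ^ K * (m * (n * n))) (suc n)))

  prefixSpread<W : ∀ (ψ : Fin n → Fin m) → prefixSpread S ψ < W
  prefixSpread<W ψ = s≤s (sumF≤n*c (suc n) (2 ^ K * (m * (n * n))) λ J → sumF≤n*c (2 ^ K) (m * (n * n)) λ t →
                          sumF≤n*c m (n * n) λ i →
                            *-mono-≤ (prefixTypeCount≤n S ψ i t (toℕ J)) (prefixTypeCount≤n S ψ i t (toℕ J)))

  -- Lexicographic in (cost, typeSpread, prefixSpread), since the last two are below W.
  potential : (Fin n → Fin m) → ℕ
  potential ψ = W * (W * cost S ψ + typeSpread S ψ) + prefixSpread S ψ

  potential-cong : ∀ {φ ψ} → (∀ j → φ j ≡ ψ j) → potential φ ≡ potential ψ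
  potential-cong {φ} {ψ} φ≗ψ = cong₂ (λ x y → W * x + y)
    (cong₂ (λ x y → W * x + y) (cost-cong S {φ} {ψ} same-counts) (typeSpread-cong S {φ} {ψ} same-counts))
    (prefixSpread-cong S {φ} {ψ} φ≗ψ)
    where
    same-counts : ∀ i t → typeCount S φ i t ≡ typeCount S ψ i t
    same-counts = typeCount-cong S {φ} {ψ} φ≗ψ

  -- Abstract, so that Agda never unfolds φ* into the exhaustive search over all assignments.
  abstract
    optimum : Σ (Fin n → Fin m) λ φ → ∀ ψ → potential φ ≤ potential ψ
    optimum = minimiser n m′ potential potential-cong

  φ* : Fin n → Fin m
  φ* = proj₁ optimum

  minimal : ∀ ψ → potential φ* ≤ potential ψ
  minimal = proj₂ optimum

  cost-optimal : ∀ ψ → cost S φ* ≤ cost S ψ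
  cost-optimal ψ with cost S φ* ≤? cost S ψ
  ... | yes ≤ψ = ≤ψ
  ... | no  ≰ψ = ⊥-elim (<⇒≱ better (minimal ψ))
    where
    better : potential ψ < potential φ*
    better = lex-< W {p = prefixSpread S φ*} (lex-< W {p = typeSpread S φ*} (≰⇒> ≰ψ) (typeSpread<W ψ)) (prefixSpread<W ψ)

  no-better-move : (Σ (Fin n → Fin m) λ φ′ → cost S φ′ ≤ cost S φ* × typeSpread S φ′ < typeSpread S φ*) → ⊥
  no-better-move (φ′ , cost-≤ , spread-<) = <⇒≱ better (minimal φ′)
    where
    better : potential φ′ < potential φ*
    better = lex-< W {p = prefixSpread S φ*} (+-mono-≤-< (*-monoʳ-≤ W cost-≤) spread-<) (prefixSpread<W φ′)

  types-balanced : ∀ a b t → typeCount S φ* a t ≤ typeCount S φ* b t + V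
  types-balanced a b t with typeCount S φ* b t + R ≤? typeCount S φ* a t
  ... | no  close = ≤-pred (≤-trans (≰⇒> close) (≤-reflexive (+-suc (typeCount S φ* b t) V)))
  ... | yes far   = ⊥-elim (no-better-move (improving-move S φ* distinct t far))
    where
    distinct : a ≢ b
    distinct refl = <-irrefl refl (<-≤-trans (m<m+n (typeCount S φ* a t) (s≤s z≤n)) far)

  no-better-swap : ∀ {x₁ x₂ : Fin n} {a b : Fin m} {t : Type K} → toℕ x₁ < toℕ x₂ → a ≢ b →
    type S x₁ ≡ t → type S x₂ ≡ t → φ* x₁ ≡ a → φ* x₂ ≡ b →
    (∀ J → toℕ x₁ < J → J ≤ toℕ x₂ → prefixTypeCount S φ* b t J + 2 ≤ prefixTypeCount S φ* a t J) → ⊥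
  no-better-swap {x₁} {x₂} x₁<x₂ a≢b type₁ type₂ φ₁ φ₂ gap = <⇒≱ better (minimal φ″)
    where
    open Swap S φ* (λ x₁≡x₂ → <-irrefl (cong toℕ x₁≡x₂) x₁<x₂) a≢b type₁ type₂ φ₁ φ₂
    better : potential φ″ < potential φ*
    better = subst (λ z → W * z + prefixSpread S φ″ < potential φ*)
                   (sym (cong₂ (λ x y → W * x + y) (cost-cong S {φ″} {φ*} typeCount-swap)
                                                   (typeSpread-cong S {φ″} {φ*} typeCount-swap)))
                   (+-monoʳ-< (W * (W * cost S φ* + typeSpread S φ*)) (prefixSpread-< x₁<x₂ gap))

  module _ {i : Fin m} {t : Type K} {j : ℕ} (j<n : j < n) where

    step : prefixTypeCount S φ* i t (suc j)
         ≡ prefixTypeCount S φ* i t j + [ type S (fromℕ< j<n) ≟ t ] * [ φ* (fromℕ< j<n) ≟ i ]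
    step = subst (λ J → prefixTypeCount S φ* i t (suc J)
                      ≡ prefixTypeCount S φ* i t J + [ type S (fromℕ< j<n) ≟ t ] * [ φ* (fromℕ< j<n) ≟ i ])
                 (toℕ-fromℕ< j<n) (prefixTypeCount-suc S φ* i t (fromℕ< j<n))

    step-≤ : prefixTypeCount S φ* i t j ≤ prefixTypeCount S φ* i t (suc j)
    step-≤ = ≤-trans (m≤m+n _ _) (≤-reflexive (sym step))

    entering : prefixTypeCount S φ* i t j < prefixTypeCount S φ* i t (suc j) →
               type S (fromℕ< j<n) ≡ t × φ* (fromℕ< j<n) ≡ i
    entering increases = [≟]*[≟]≢0 λ none →
      <-irrefl (sym (trans step (trans (cong (_+_ (prefixTypeCount S φ* i t j)) none) (+-identityʳ _)))) increases

  module _ (a b : Fin m) (t : Type K) where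

    private
      p q : ℕ → ℕ
      p = prefixTypeCount S φ* a t
      q = prefixTypeCount S φ* b t

    balanced-all : p n ≤ q n + R
    balanced-all = subst₂ (λ u v → u ≤ v + R) (sym (prefixTypeCount-all S φ* a t)) (sym (prefixTypeCount-all S φ* b t))
                          (≤-trans (types-balanced a b t) (+-monoʳ-≤ (typeCount S φ* b t) (n≤1+n V)))

    -- The job entering at the start of a stretch where a leads b by more than R went to a, the job ending
    -- it went to b, and swapping the two would lower the potential.
    no-unbalanced-stretch : ∀ {j₁ j₂} → j₁ < j₂ → j₂ < n → p j₁ ≤ q j₁ + R →
      (∀ J → j₁ < J → J ≤ j₂ → q J + R < p J) → p (suc j₂) ≤ q (suc j₂) + R → ⊥
    no-unbalanced-stretch {j₁} {j₂} j₁<j₂ j₂<n balanced₁ unbalanced balanced₂ =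
      no-better-swap x₁<x₂ a≢b (proj₁ a-enters) (proj₁ b-enters) (proj₂ a-enters) (proj₂ b-enters) gap
      where
      j₁<n : j₁ < n
      j₁<n = <-trans j₁<j₂ j₂<n
      a≢b : a ≢ b
      a≢b refl = <⇒≱ (unbalanced (suc j₁) ≤-refl j₁<j₂) (m≤m+n (p (suc j₁)) R)
      a-enters : type S (fromℕ< j₁<n) ≡ t × φ* (fromℕ< j₁<n) ≡ a
      a-enters = entering j₁<n
        (≤-<-trans (≤-trans balanced₁ (+-monoˡ-≤ R (step-≤ j₁<n))) (unbalanced (suc j₁) ≤-refl j₁<j₂))
      b-enters : type S (fromℕ< j₂<n) ≡ t × φ* (fromℕ< j₂<n) ≡ b
      b-enters = entering j₂<n
        (+-cancelʳ-< R _ _ (<-≤-trans (unbalanced j₂ j₁<j₂ ≤-refl) (≤-trans (step-≤ j₂<n) balanced₂)))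
      x₁<x₂ : toℕ (fromℕ< j₁<n) < toℕ (fromℕ< j₂<n)
      x₁<x₂ = subst₂ _<_ (sym (toℕ-fromℕ< j₁<n)) (sym (toℕ-fromℕ< j₂<n)) j₁<j₂
      gap : ∀ J → toℕ (fromℕ< j₁<n) < J → J ≤ toℕ (fromℕ< j₂<n) → q J + 2 ≤ p J
      gap J x₁<J J≤x₂ = ≤-trans (+-monoʳ-≤ (q J) (s≤s (s≤s z≤n))) (≤-trans (≤-reflexive (+-suc (q J) R))
        (unbalanced J (subst (_< J) (toℕ-fromℕ< j₁<n) x₁<J) (subst (J ≤_) (toℕ-fromℕ< j₂<n) J≤x₂)))

    -- Around an unbalanced prefix J₀, take the first unbalanced prefix and then the first balanced one after it.
    prefixes-balanced : ∀ J → J ≤ n → p J ≤ q J + R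
    prefixes-balanced J₀ J₀≤n with p J₀ ≤? q J₀ + R
    ... | yes balanced = balanced
    ... | no unbalanced with first-from (λ J → q J + R <? p J) 0 J₀ (≰⇒> unbalanced)
    ...   | zero , _ , _ , unbalanced₀ , _ =
      ⊥-elim (n≮0 (subst (q 0 + R <_) (prefixTypeCount-zero S φ* a t) unbalanced₀))
    ...   | suc j₁ , _ , J₁≤J₀ , unbalanced₁ , balanced-before
      with first-from (λ J → p J ≤? q J + R) (suc j₁) (n ∸ suc j₁)
                      (subst (λ J → p J ≤ q J + R) (sym (m+[n∸m]≡n (≤-trans J₁≤J₀ J₀≤n))) balanced-all)
    ...     | J₂ , J₁≤J₂ , J₂≤n , balanced₂ , unbalanced-between with m≤n⇒m<n∨m≡n J₁≤J₂
    ...       | inj₂ refl = ⊥-elim (<⇒≱ unbalanced₁ balanced₂)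
    ...       | inj₁ (s≤s {n = j₂} j₁<j₂) = ⊥-elim (no-unbalanced-stretch j₁<j₂
      (≤-trans J₂≤n (≤-reflexive (m+[n∸m]≡n (≤-trans J₁≤J₀ J₀≤n)))) (≮⇒≥ (balanced-before j₁ z≤n ≤-refl))
      (λ J j₁<J J≤j₂ → ≰⇒> (unbalanced-between J j₁<J (s≤s J≤j₂))) balanced₂)

  prefixCount-close : ∀ a b k j → prefixCount S φ* a k j ≤ prefixCount S φ* b k j + 2 ^ K * R
  prefixCount-close a b k j = begin
      prefixCount S φ* a k j
    ≡⟨ prefixCount-by-type S φ* a k j ⟩
      sumF (2 ^ K) (λ t → occurs t k * prefixTypeCount S φ* a t J)
    ≤⟨ sumF-mono-≤ (2 ^ K) (λ t → *-monoʳ-≤ (occurs t k) (prefixes-balanced a b t J (toℕ<n j))) ⟩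
      sumF (2 ^ K) (λ t → occurs t k * (prefixTypeCount S φ* b t J + R))
    ≡⟨ trans (sumF-cong (2 ^ K) (λ t → *-distribˡ-+ (occurs t k) _ R)) (sumF-distrib-+ (2 ^ K) _ _) ⟩
      sumF (2 ^ K) (λ t → occurs t k * prefixTypeCount S φ* b t J) + sumF (2 ^ K) (λ t → occurs t k * R)
    ≤⟨ +-monoʳ-≤ _ (sumF≤n*c (2 ^ K) R (λ t → ≤-trans (*-monoˡ-≤ R (occurs≤1 t k)) (≤-reflexive (+-identityʳ R)))) ⟩
      sumF (2 ^ K) (λ t → occurs t k * prefixTypeCount S φ* b t J) + 2 ^ K * R
    ≡⟨ cong (_+ 2 ^ K * R) (sym (prefixCount-by-type S φ* b k j)) ⟩
      prefixCount S φ* b k j + 2 ^ K * R ∎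
    where
    open ≤-Reasoning
    J : ℕ
    J = suc (toℕ j)

  totalCost-optimal : ∀ ψ → totalCost unitW S φ* ≤ totalCost unitW S ψ
  totalCost-optimal ψ = subst₂ _≤_ (sym (totalCost-unitW S φ*)) (sym (totalCost-unitW S ψ)) (cost-optimal ψ)

  full-disbalance : fullDisbalance S φ* ≤ 2 ^ K * R
  full-disbalance = maxF≤ n _ _ λ j → maxF≤ K _ _ λ k →
    maxF∸minF≤ m′ (λ i → prefixCount S φ* i k j) _ (λ a b → prefixCount-close a b k j)

disbalanceBound : ℕ → ℕ
disbalanceBound K = 2 ^ K * ExchangeVector.R (occurs {K}) occurs≤1

theorem6 : Σ (ℕ → ℕ) λ g →
    (n m K : ℕ) → 1 ≤ m → (S : Fin K → Subset n) →
    Σ (Fin n → Fin m) λ φ →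
      ((ψ : Fin n → Fin m) → totalCost unitW S φ ≤ totalCost unitW S ψ)
      × fullDisbalance S φ ≤ g K
theorem6 = disbalanceBound , λ where
  n (suc m′) K _ S → let open Optimum {n} {m′} {K} S in φ* , totalCost-optimal , full-disbalance
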